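{- For any positive integers $n$ and $k$ such that $k\le 2^n$, we have $v_2(s(2^n,k))\le v_2(s(2^n,1))$.
   Context: For nonnegative integers $n,k$, the (unsigned) Stirling number of the first kind $s(n,k)$ is defined by $x(x+1)\cdots(x+n-1)=\sum_{k=0}^{n}s(n,k)x^k$, with $s(n,k)=0$ for $k>n$. $v_2$ denotes the 2-adic valuation. -}

module Defs where

open import Data.Nat using (ℕ; zero; suc; _+_; _*_)
open import Data.Nat.DivMod using (_/_; _%_)
open import Data.Bool using (Bool; true; false; if_then_else_)
open import Data.Nat using (_≡ᵇ_)

-- Unsigned Stirling numbers of the first kind, via the standard recurrence
-- coming from x(x+1)...(x+n-1)(x+n) = (x + n) * (previous product):
--   s(0,0) = 1, s(0,k+1) = 0, s(n+1,0) = 0,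
--   s(n+1,k+1) = n * s(n,k+1) + s(n,k).
stirling1 : ℕ → ℕ → ℕ
stirling1 zero    zero    = 1
stirling1 zero    (suc k) = 0
stirling1 (suc n) zero    = 0
stirling1 (suc n) (suc k) = n * stirling1 n (suc k) + stirling1 n k

-- 2-adic valuation with fuel; v2 m = largest e with 2^e ∣ m for m > 0
-- (fuel m suffices since v2 m ≤ m); convention v2 0 = 0 (never used here).
v2-fuel : ℕ → ℕ → ℕ
v2-fuel zero     m = 0
v2-fuel (suc f) zero = 0
v2-fuel (suc f) (suc m) with (suc m) % 2
... | zero  = suc (v2-fuel f ((suc m) / 2))
... | suc _ = 0

v2 : ℕ → ℕ
v2 m = v2-fuel m m

-- We prove the stronger exact formula v₂(s(2^n, k)) = ν n k, for an explicit, recursively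
-- defined ν (ValuationFormula), and then check that ν n k ≤ ν n 1 (FormulaMaximum). With N = 2^n,
--   x(x + 1)⋯(x + 2N - 1) = A(x) · B(x),  A = ∏_{i<N} (x + 2i + 1),  B = ∏_{i<N} (x + 2i),
-- where B_j = 2^(N - j) s(N, j) is known by induction. Pairing the odd factors
-- 2i + 1 and 2N - 2i - 1, whose sum is 2N, gives A = G(x²) + 2N·x·G'(x²) + (2N)²·R (Pairing)
-- for a polynomial G = G_{n-1} whose coefficients have valuation n - 1 - v₂(j) (OddPairs,
-- proved by induction via G_{m+1} ≡ G_m² and the squaring lemma of Squaring). This determines
-- the valuations of the coefficients of A. Finally, in s(2N, k) = Σ_t A_t B_{k-t} a single
-- term attains the minimal valuation ν (n + 1) k (DominantTerm), so the sum has exactly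
-- that valuation.
module Submission where

open import Defs
open import Data.Nat using (ℕ; _≤_; _^_; NonZero)
open import Data.Nat using (z≤n; s≤s)
open import Data.Nat.Properties using (m^n>0)
open import Relation.Binary.PropositionalEquality using (sym; subst₂)

module TwoAdic where

  open import Data.Nat
  open import Data.Nat.Properties
  open import Data.Nat.Divisibility
  open import Data.Nat.DivMod
  open import Data.Empty using (⊥; ⊥-elim)
  open import Relation.Nullary using (¬_; yes; no)
  open import Relation.Binary.Definitions using (tri<; tri≈; tri>)
  open import Relation.Binary.PropositionalEquality
  open import Data.Nat.Tactic.RingSolver using (solve-∀)

  infix 4 2^_∣_ 2^_‖_
  infixr 4 _,_

  -- "2^e divides x": the library's divisibility, wrapped in a record so that the
  -- exponent e can be inferred from the type.
  record 2^_∣_ (e x : ℕ) : Set where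
    constructor pow∣
    field
      divides-by : 2 ^ e ∣ x

  record 2^_‖_ (e x : ℕ) : Set where
    constructor _,_
    field
      oddHalf : ℕ
      decomposition : x ≡ 2 ^ e * suc (2 * oddHalf)

  pow∣0 : ∀ e → 2^ e ∣ 0
  pow∣0 e = pow∣ ((2 ^ e) ∣0)

  pow∣-pow* : ∀ e y → 2^ e ∣ 2 ^ e * y
  pow∣-pow* e y = pow∣ (m∣m*n y)

  pow∣-+ : ∀ {e x y} → 2^ e ∣ x → 2^ e ∣ y → 2^ e ∣ x + y
  pow∣-+ (pow∣ d) (pow∣ d') = pow∣ (∣m∣n⇒∣m+n d d')

  pow∣-+-cancel : ∀ {e x y} → 2^ e ∣ x + y → 2^ e ∣ x → 2^ e ∣ y
  pow∣-+-cancel (pow∣ d) (pow∣ d') = pow∣ (∣m+n∣m⇒∣n d d')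

  pow∣-*ʳ : ∀ {e x} y → 2^ e ∣ x → 2^ e ∣ x * y
  pow∣-*ʳ y (pow∣ d) = pow∣ (∣m⇒∣m*n y d)

  pow∣-* : ∀ {e f x y} → 2^ e ∣ x → 2^ f ∣ y → 2^ (e + f) ∣ x * y
  pow∣-* {e} {f} (pow∣ d) (pow∣ d') = pow∣ (subst (_∣ _) (sym (^-distribˡ-+-* 2 e f)) (*-pres-∣ d d'))

  pow∣pow : ∀ {e f} → e ≤ f → 2^ e ∣ 2 ^ f
  pow∣pow {e} {f} e≤f =
    pow∣ (divides (2 ^ (f ∸ e)) (trans (cong (2 ^_) (sym (m∸n+n≡m e≤f))) (^-distribˡ-+-* 2 (f ∸ e) e)))

  pow∣-weaken : ∀ {e f x} → e ≤ f → 2^ f ∣ x → 2^ e ∣ x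
  pow∣-weaken e≤f (pow∣ d) = pow∣ (∣-trans (2^_∣_.divides-by (pow∣pow e≤f)) d)

  pow∣⇒≤ : ∀ {e x} → 2^ e ∣ x → 0 < x → 2 ^ e ≤ x
  pow∣⇒≤ (pow∣ d) x>0 = ∣⇒≤ {{>-nonZero x>0}} d

  data Parity (x : ℕ) : Set where
    even : ∀ h → x ≡ 2 * h → Parity x
    odd  : ∀ h → x ≡ suc (2 * h) → Parity x

  parity-of : ∀ x → Parity x
  parity-of zero = even 0 refl
  parity-of (suc x) with parity-of x
  ... | even h p = odd h (cong suc p)
  ... | odd h p = even (suc h) (trans (cong suc p) (lem h))
    where
    lem : ∀ h → suc (suc (2 * h)) ≡ 2 * suc h
    lem = solve-∀

  2∤odd : ∀ q → ¬ 2 ∣ suc (2 * q)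
  2∤odd q (divides c eq) = even≢odd c q (sym (trans eq (*-comm c 2)))

  even∧odd⇒⊥ : ∀ {x} h k → x ≡ 2 * h → x ≡ suc (2 * k) → ⊥
  even∧odd⇒⊥ h k p q = even≢odd h k (trans (sym p) q)

  twice : ∀ n → 2 * n ≡ n + n
  twice n = cong (n +_) (+-identityʳ n)

  -- Doubling by explicit recursion, so that dbl (suc n) reduces to suc (suc (dbl n)).
  dbl : ℕ → ℕ
  dbl zero = zero
  dbl (suc n) = suc (suc (dbl n))

  dbl≡ : ∀ n → dbl n ≡ 2 * n
  dbl≡ zero = refl
  dbl≡ (suc n) = trans (cong (λ z → suc (suc z)) (dbl≡ n)) (lem n)
    where
    lem : ∀ n → 2 + 2 * n ≡ 2 * (1 + n)
    lem = solve-∀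

  ‖⇒∣ : ∀ {e x} → 2^ e ‖ x → 2^ e ∣ x
  ‖⇒∣ {e} (q , p) = pow∣ (divides (suc (2 * q)) (trans p (*-comm (2 ^ e) _)))

  ‖⇒∤ : ∀ {e x} → 2^ e ‖ x → ¬ 2^ suc e ∣ x
  ‖⇒∤ {e} (q , refl) (pow∣ d) = 2∤odd q (*-cancelˡ-∣ (2 ^ e) {{m^n≢0 2 e}} (subst (_∣ 2 ^ e * suc (2 * q)) (*-comm 2 (2 ^ e)) d))

  ‖⇒>0 : ∀ {e x} → 2^ e ‖ x → 0 < x
  ‖⇒>0 {e} {zero} v = ⊥-elim (‖⇒∤ v (pow∣0 (suc e)))
  ‖⇒>0 {e} {suc _} v = z<s

  ∣-‖-≤ : ∀ {e f x} → 2^ f ∣ x → 2^ e ‖ x → f ≤ e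
  ∣-‖-≤ {e} {f} d v with f ≤? e
  ... | yes p = p
  ... | no p = ⊥-elim (‖⇒∤ v (pow∣-weaken (≰⇒> p) d))

  ‖-unique : ∀ {e f x} → 2^ e ‖ x → 2^ f ‖ x → e ≡ f
  ‖-unique v w = ≤-antisym (∣-‖-≤ (‖⇒∣ v) w) (∣-‖-≤ (‖⇒∣ w) v)

  ‖-+-higher : ∀ {e x y} → 2^ e ‖ x → 2^ suc e ∣ y → 2^ e ‖ x + y
  ‖-+-higher {e} (q , refl) (pow∣ (divides c refl)) = q + c , lem (2 ^ e) q c
    where
    lem : ∀ a q c → a * suc (2 * q) + c * (2 * a) ≡ a * suc (2 * (q + c))
    lem = solve-∀

  ‖-+-higherˡ : ∀ {e x y} → 2^ suc e ∣ y → 2^ e ‖ x → 2^ e ‖ y + x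
  ‖-+-higherˡ {e} {x} {y} d v = subst (2^ e ‖_) (+-comm x y) (‖-+-higher v d)

  ‖-* : ∀ {e f x y} → 2^ e ‖ x → 2^ f ‖ y → 2^ (e + f) ‖ x * y
  ‖-* {e} {f} (q , refl) (r , refl) = q + r + 2 * q * r , (begin
     2 ^ e * suc (2 * q) * (2 ^ f * suc (2 * r))   ≡⟨ lem (2 ^ e) (2 ^ f) q r ⟩
     2 ^ e * 2 ^ f * suc (2 * (q + r + 2 * q * r)) ≡⟨ cong (_* _) (sym (^-distribˡ-+-* 2 e f)) ⟩
     2 ^ (e + f) * suc (2 * (q + r + 2 * q * r))   ∎)
    where
    open ≡-Reasoning
    lem : ∀ a b q r → a * suc (2 * q) * (b * suc (2 * r)) ≡ a * b * suc (2 * (q + r + 2 * q * r))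
    lem = solve-∀

  ‖-pow : ∀ e → 2^ e ‖ 2 ^ e
  ‖-pow e = 0 , sym (*-identityʳ (2 ^ e))

  ‖-odd : ∀ q → 2^ 0 ‖ suc (2 * q)
  ‖-odd q = q , sym (+-identityʳ _)

  ‖-one : 2^ 0 ‖ 1
  ‖-one = ‖-odd 0

  ‖-pow* : ∀ {e x} f → 2^ e ‖ x → 2^ (f + e) ‖ 2 ^ f * x
  ‖-pow* f v = ‖-* (‖-pow f) v

  ‖-double : ∀ {e x} → 2^ e ‖ x → 2^ suc e ‖ 2 * x
  ‖-double = ‖-pow* 1

  v2-fuel-correct : ∀ f x → x ≤ f → 0 < x → 2^ v2-fuel f x ‖ x
  v2-fuel-correct (suc f) (suc m) x≤f _ with suc m % 2 | m≡m%n+[m/n]*n (suc m) 2 | m%n<n (suc m) 2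
  ... | zero | x≡ | _ = subst (2^ suc (v2-fuel f h) ‖_) (sym x≡2h) (‖-double (v2-fuel-correct f h h≤f h>0))
    where
    h : ℕ
    h = suc m / 2
    x≡2h : suc m ≡ 2 * h
    x≡2h = trans x≡ (*-comm h 2)
    h>0 : 0 < h
    h>0 = n≢0⇒n>0 (λ h≡0 → 1+n≢0 (trans x≡2h (cong (2 *_) h≡0)))
    h≤f : h ≤ f
    h≤f = ≤-trans (s≤s⁻¹ (m/n<m (suc m) 2 (s≤s (s≤s z≤n)))) (s≤s⁻¹ x≤f)
  ... | suc zero | x≡ | _ = subst (2^ 0 ‖_) (sym (trans x≡ (cong suc (*-comm (suc m / 2) 2)))) (‖-odd (suc m / 2))
  ... | suc (suc _) | _ | s≤s (s≤s ())

  v2-correct : ∀ x → 0 < x → 2^ v2 x ‖ x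
  v2-correct x x>0 = v2-fuel-correct x x ≤-refl x>0

  v2-exact : ∀ {e x} → 2^ e ‖ x → v2 x ≡ e
  v2-exact v = ‖-unique (v2-correct _ (‖⇒>0 v)) v

  ‖-+-cancel-higher : ∀ {e x y} → 2^ e ‖ x + y → 2^ suc e ∣ y → 2^ e ‖ x
  ‖-+-cancel-higher {e} {zero} v d = ⊥-elim (‖⇒∤ v d)
  ‖-+-cancel-higher {e} {x@(suc _)} {y} v d with <-cmp (v2 x) e
  ... | tri< p _ _ = ⊥-elim (<-irrefl (‖-unique (‖-+-higher (v2-correct x z<s) (pow∣-weaken (m≤n⇒m≤1+n p) d)) v) p)
  ... | tri≈ _ p _ = subst (2^_‖ x) p (v2-correct x z<s)
  ... | tri> _ _ p = ⊥-elim (‖⇒∤ v (pow∣-+ (pow∣-weaken p (‖⇒∣ (v2-correct x z<s))) d))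

  v2-double : ∀ x → 0 < x → v2 (2 * x) ≡ suc (v2 x)
  v2-double x p = v2-exact (‖-double (v2-correct x p))

  v2-pow : ∀ e → v2 (2 ^ e) ≡ e
  v2-pow e = v2-exact (‖-pow e)

  pow-v2≤ : ∀ x → 0 < x → 2 ^ v2 x ≤ x
  pow-v2≤ x p = pow∣⇒≤ (‖⇒∣ (v2-correct x p)) p

  n<2^n : ∀ n → n < 2 ^ n
  n<2^n zero = z<s
  n<2^n (suc n) = subst (_< 2 ^ suc n) (+-comm n 1) (+-mono-<-≤ (n<2^n n) (≤-trans (m^n>0 2 n) (m≤m+n (2 ^ n) 0)))

  ^-cancel-< : ∀ {a b} → 2 ^ a < 2 ^ b → a < b
  ^-cancel-< {a} {b} p with a <? b
  ... | yes q = q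
  ... | no q = ⊥-elim (<⇒≱ p (^-monoʳ-≤ 2 (≮⇒≥ q)))

  ^-cancel-≤ : ∀ {a b} → 2 ^ a ≤ 2 ^ b → a ≤ b
  ^-cancel-≤ {a} {b} p with a ≤? b
  ... | yes q = q
  ... | no q = ⊥-elim (<⇒≱ (^-monoʳ-< 2 (s≤s (s≤s z≤n)) (≰⇒> q)) p)

  v2<n : ∀ x n → 0 < x → x < 2 ^ n → v2 x < n
  v2<n x n p q = ^-cancel-< (≤-<-trans (pow-v2≤ x p) q)

  v2≤n : ∀ x n → 0 < x → x ≤ 2 ^ n → v2 x ≤ n
  v2≤n x n p q = ^-cancel-≤ (≤-trans (pow-v2≤ x p) q)

  v2<self : ∀ x → 0 < x → v2 x < x
  v2<self x p = <-≤-trans (n<2^n (v2 x)) (pow-v2≤ x p)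

  v2-+-min : ∀ x y → 0 < x → 0 < y → v2 x ⊓ v2 y ≤ v2 (x + y)
  v2-+-min x y px py = ∣-‖-≤ (pow∣-+ (divides-x (m⊓n≤m _ _) px) (divides-x (m⊓n≤n _ _) py))
                             (v2-correct (x + y) (<-≤-trans px (m≤m+n x y)))
    where
    divides-x : ∀ {e z} → e ≤ v2 z → 0 < z → 2^ e ∣ z
    divides-x e≤ pz = pow∣-weaken e≤ (‖⇒∣ (v2-correct _ pz))

module Poly where

  open import Data.Nat
  open import Data.Nat.Properties
  open import Relation.Nullary using (yes; no)
  open import Relation.Binary.PropositionalEquality
  open import Data.Nat.Tactic.RingSolver using (solve-∀)
  open TwoAdic

  sumTo : (ℕ → ℕ) → ℕ → ℕ
  sumTo f zero = 0
  sumTo f (suc m) = sumTo f m + f m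

  sum-ext : ∀ {f g} m → (∀ i → i < m → f i ≡ g i) → sumTo f m ≡ sumTo g m
  sum-ext zero h = refl
  sum-ext (suc m) h = cong₂ _+_ (sum-ext m (λ i p → h i (m≤n⇒m≤1+n p))) (h m ≤-refl)

  sum-+ : ∀ f g m → sumTo (λ i → f i + g i) m ≡ sumTo f m + sumTo g m
  sum-+ f g zero = refl
  sum-+ f g (suc m) = trans (cong (_+ (f m + g m)) (sum-+ f g m)) (lem (sumTo f m) (sumTo g m) (f m) (g m))
    where
    lem : ∀ a b c d → a + b + (c + d) ≡ a + c + (b + d)
    lem = solve-∀

  sum-* : ∀ c f m → sumTo (λ i → c * f i) m ≡ c * sumTo f m
  sum-* c f zero = sym (*-zeroʳ c)
  sum-* c f (suc m) = trans (cong (_+ c * f m) (sum-* c f m)) (sym (*-distribˡ-+ c (sumTo f m) (f m)))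

  sum-front : ∀ f m → sumTo f (suc m) ≡ f 0 + sumTo (λ i → f (suc i)) m
  sum-front f zero = +-comm 0 (f 0)
  sum-front f (suc m) = trans (cong (_+ f (suc m)) (sum-front f m)) (+-assoc (f 0) _ _)

  sum-split : ∀ f a b → sumTo f (a + b) ≡ sumTo f a + sumTo (λ i → f (a + i)) b
  sum-split f a zero = trans (cong (sumTo f) (+-identityʳ a)) (sym (+-identityʳ _))
  sum-split f a (suc b) = trans (cong (sumTo f) (+-suc a b))
    (trans (cong (_+ f (a + b)) (sum-split f a b)) (+-assoc (sumTo f a) _ _))

  sum-zero : ∀ f m → (∀ i → i < m → f i ≡ 0) → sumTo f m ≡ 0
  sum-zero f zero h = refl
  sum-zero f (suc m) h = cong₂ _+_ (sum-zero f m (λ i p → h i (m≤n⇒m≤1+n p))) (h m ≤-refl)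

  sum-rev : ∀ f m → sumTo f m ≡ sumTo (λ i → f (m ∸ suc i)) m
  sum-rev f zero = refl
  sum-rev f (suc m) = begin
    sumTo f m + f m                              ≡⟨ +-comm (sumTo f m) (f m) ⟩
    f m + sumTo f m                              ≡⟨ cong (f m +_) (sum-rev f m) ⟩
    f m + sumTo (λ i → f (m ∸ suc i)) m          ≡⟨ sym (sum-front (λ i → f (suc m ∸ suc i)) m) ⟩
    sumTo (λ i → f (suc m ∸ suc i)) (suc m)      ∎
    where open ≡-Reasoning

  sum-pow∣ : ∀ {e} f m → (∀ i → i < m → 2^ e ∣ f i) → 2^ e ∣ sumTo f m
  sum-pow∣ {e} f zero h = pow∣0 e
  sum-pow∣ f (suc m) h = pow∣-+ (sum-pow∣ f m (λ i p → h i (m≤n⇒m≤1+n p))) (h m ≤-refl)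

  sum-‖-dominant : ∀ {e} f m i₀ → i₀ < m → 2^ e ‖ f i₀ →
    (∀ i → i < m → i ≢ i₀ → 2^ suc e ∣ f i) → 2^ e ‖ sumTo f m
  sum-‖-dominant f (suc m) i₀ p v h with i₀ ≟ m
  ... | yes refl = ‖-+-higherˡ (sum-pow∣ f m (λ i q → h i (m≤n⇒m≤1+n q) (λ eq → <-irrefl eq q))) v
  ... | no ne = ‖-+-higher (sum-‖-dominant f m i₀ (≤∧≢⇒< (≤-pred p) ne) v (λ i q → h i (m≤n⇒m≤1+n q)))
                           (h m ≤-refl (λ eq → ne (sym eq)))

  Poly : Set
  Poly = ℕ → ℕ

  infix 4 _≐_
  _≐_ : Poly → Poly → Set
  p ≐ q = ∀ k → p k ≡ q k

  ≐-trans : ∀ {p q r} → p ≐ q → q ≐ r → p ≐ r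
  ≐-trans a b k = trans (a k) (b k)

  ≐-sym : ∀ {p q} → p ≐ q → q ≐ p
  ≐-sym a k = sym (a k)

  𝟙 : Poly
  𝟙 zero = 1
  𝟙 (suc k) = 0

  shift : Poly → Poly
  shift p zero = 0
  shift p (suc k) = p k

  linMul : ℕ → Poly → Poly
  linMul c p k = c * p k + shift p k

  conv : Poly → Poly → Poly
  conv p q k = sumTo (λ i → p i * q (k ∸ i)) (suc k)

  conv-ext : ∀ {p p' q q'} → p ≐ p' → q ≐ q' → conv p q ≐ conv p' q'
  conv-ext e e' k = sum-ext (suc k) (λ i _ → cong₂ _*_ (e i) (e' (k ∸ i)))

  linMul-ext : ∀ {p p'} c → p ≐ p' → linMul c p ≐ linMul c p'
  linMul-ext c e zero = cong (λ z → c * z + 0) (e 0)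
  linMul-ext c e (suc k) = cong₂ (λ a b → c * a + b) (e (suc k)) (e k)

  conv-shift-l : ∀ p q → conv (shift p) q ≐ shift (conv p q)
  conv-shift-l p q zero = refl
  conv-shift-l p q (suc k) = sum-front _ (suc k)

  conv-shift-r : ∀ p q → conv p (shift q) ≐ shift (conv p q)
  conv-shift-r p q zero = cong (0 +_) (*-zeroʳ (p 0))
  conv-shift-r p q (suc k) = trans
    (cong₂ _+_ (sum-ext (suc k) (λ i i<k → cong (λ z → p i * shift q z) (+-∸-assoc 1 (≤-pred i<k))))
               (trans (cong (λ z → p (suc k) * shift q z) (n∸n≡0 k)) (*-zeroʳ (p (suc k)))))
    (+-identityʳ _)

  conv-scal-l : ∀ c p q → conv (λ i → c * p i) q ≐ (λ k → c * conv p q k)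
  conv-scal-l c p q k = trans (sum-ext (suc k) (λ i _ → *-assoc c (p i) _)) (sum-* c _ (suc k))

  conv-scal-r : ∀ c p q → conv p (λ i → c * q i) ≐ (λ k → c * conv p q k)
  conv-scal-r c p q k = trans (sum-ext (suc k) (λ i _ → lem c (p i) (q (k ∸ i)))) (sum-* c _ (suc k))
    where
    lem : ∀ c a b → a * (c * b) ≡ c * (a * b)
    lem = solve-∀

  conv-add-l : ∀ p p' q → conv (λ i → p i + p' i) q ≐ (λ k → conv p q k + conv p' q k)
  conv-add-l p p' q k = trans (sum-ext (suc k) (λ i _ → *-distribʳ-+ (q (k ∸ i)) (p i) (p' i))) (sum-+ _ _ (suc k))

  conv-add-r : ∀ p q q' → conv p (λ i → q i + q' i) ≐ (λ k → conv p q k + conv p q' k)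
  conv-add-r p q q' k = trans (sum-ext (suc k) (λ i _ → *-distribˡ-+ (p i) (q (k ∸ i)) (q' (k ∸ i)))) (sum-+ _ _ (suc k))

  linMul-conv-l : ∀ c p q → conv (linMul c p) q ≐ linMul c (conv p q)
  linMul-conv-l c p q k = trans (conv-add-l (λ i → c * p i) (shift p) q k)
                                (cong₂ _+_ (conv-scal-l c p q k) (conv-shift-l p q k))

  linMul-conv-r : ∀ c p q → conv p (linMul c q) ≐ linMul c (conv p q)
  linMul-conv-r c p q k = trans (conv-add-r p (λ i → c * q i) (shift q) k)
                                (cong₂ _+_ (conv-scal-r c p q k) (conv-shift-r p q k))

  conv-𝟙-l : ∀ q → conv 𝟙 q ≐ q
  conv-𝟙-l q k = trans (sum-front _ k)
    (trans (cong (q k + 0 +_) (sum-zero _ k (λ i _ → refl))) (trans (+-identityʳ _) (+-identityʳ _)))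

  conv-𝟙-r : ∀ p → conv p 𝟙 ≐ p
  conv-𝟙-r p k = trans
    (cong₂ _+_ (sum-zero _ k (λ i i<k → trans (cong (λ z → p i * 𝟙 z) (∸-suc i<k)) (*-zeroʳ (p i))))
               (cong (λ z → p k * 𝟙 z) (n∸n≡0 k)))
    (*-identityʳ (p k))
    where
    ∸-suc : ∀ {i k} → i < k → k ∸ i ≡ suc (k ∸ suc i)
    ∸-suc {i} i<k = +-∸-assoc 1 i<k

  prodLin : (ℕ → ℕ) → ℕ → Poly
  prodLin f zero = 𝟙
  prodLin f (suc m) = linMul (f m) (prodLin f m)

  prodPair : (ℕ → ℕ) → (ℕ → ℕ) → ℕ → Poly
  prodPair f g zero = 𝟙
  prodPair f g (suc m) = linMul (f m) (linMul (g m) (prodPair f g m))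

  prodLin-ext : ∀ {f g} m → (∀ i → i < m → f i ≡ g i) → prodLin f m ≐ prodLin g m
  prodLin-ext zero h k = refl
  prodLin-ext {f} {g} (suc m) h = ≐-trans (linMul-ext (f m) (prodLin-ext m (λ i p → h i (m≤n⇒m≤1+n p))))
     (λ k → cong (λ c → linMul c (prodLin g m) k) (h m ≤-refl))

  prodLin-split : ∀ f a b → prodLin f (a + b) ≐ conv (prodLin f a) (prodLin (λ i → f (a + i)) b)
  prodLin-split f a zero = ≐-trans (λ k → cong (λ z → prodLin f z k) (+-identityʳ a)) (≐-sym (conv-𝟙-r (prodLin f a)))
  prodLin-split f a (suc b) = ≐-trans (λ k → cong (λ z → prodLin f z k) (+-suc a b))
    (≐-trans (linMul-ext (f (a + b)) (prodLin-split f a b))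
             (≐-sym (linMul-conv-r (f (a + b)) (prodLin f a) (prodLin (λ i → f (a + i)) b))))

  prodLin-merge : ∀ f g m → conv (prodLin f m) (prodLin g m) ≐ prodPair f g m
  prodLin-merge f g zero = conv-𝟙-l 𝟙
  prodLin-merge f g (suc m) = ≐-trans (linMul-conv-l (f m) (prodLin f m) (prodLin g (suc m)))
     (linMul-ext (f m) (≐-trans (linMul-conv-r (g m) (prodLin f m) (prodLin g m)) (linMul-ext (g m) (prodLin-merge f g m))))

  prodLin-dbl : ∀ g m → prodLin g (dbl m) ≐ prodPair (λ i → g (suc (dbl i))) (λ i → g (dbl i)) m
  prodLin-dbl g zero k = refl
  prodLin-dbl g (suc m) = linMul-ext (g (suc (dbl m))) (linMul-ext (g (dbl m)) (prodLin-dbl g m))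

  prodLin-front : ∀ f m → prodLin f (suc m) ≐ linMul (f 0) (prodLin (λ i → f (suc i)) m)
  prodLin-front f m = ≐-trans (prodLin-split f 1 m)
    (≐-trans (linMul-conv-l (f 0) 𝟙 (prodLin (λ i → f (suc i)) m)) (linMul-ext (f 0) (conv-𝟙-l (prodLin (λ i → f (suc i)) m))))

  prodLin-rev : ∀ f m → prodLin f m ≐ prodLin (λ i → f (m ∸ suc i)) m
  prodLin-rev f zero k = refl
  prodLin-rev f (suc m) = ≐-trans (prodLin-front f m)
    (≐-trans (linMul-ext (f 0) (prodLin-rev (λ i → f (suc i)) m))
    (≐-trans (linMul-ext (f 0) (prodLin-ext m (λ i p → cong f (sym (+-∸-assoc 1 p)))))
     (λ k → cong (λ c → linMul (f c) (prodLin (λ i → f (suc m ∸ suc i)) m) k) (sym (n∸n≡0 m)))))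

  prodLin-deg : ∀ f m k → m < k → prodLin f m k ≡ 0
  prodLin-deg f zero (suc k) _ = refl
  prodLin-deg f (suc m) (suc k) (s≤s p) =
    trans (cong₂ _+_ (cong (f m *_) (prodLin-deg f m (suc k) (m≤n⇒m≤1+n p))) (prodLin-deg f m k p))
          (cong (_+ 0) (*-zeroʳ (f m)))

  prodLin-lead : ∀ f m → prodLin f m m ≡ 1
  prodLin-lead f zero = refl
  prodLin-lead f (suc m) =
    trans (cong₂ _+_ (cong (f m *_) (prodLin-deg f m (suc m) ≤-refl)) (prodLin-lead f m)) (cong (_+ 1) (*-zeroʳ (f m)))

  -- Doubling all constants: ∏ (x + 2 f_i) = 2^m ∏ (x/2 + f_i), coefficientwise.
  prodLin-double : ∀ f m k → 2 ^ k * prodLin (λ i → 2 * f i) m k ≡ 2 ^ m * prodLin f m k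
  prodLin-double f zero zero = refl
  prodLin-double f zero (suc k) = *-zeroʳ (2 ^ suc k)
  prodLin-double f (suc m) zero = begin
      1 * (2 * f m * B 0 + 0)  ≡⟨ l1 (f m) (B 0) ⟩
      2 * f m * (1 * B 0)      ≡⟨ cong (2 * f m *_) (prodLin-double f m 0) ⟩
      2 * f m * (2 ^ m * P 0)  ≡⟨ l2 (f m) (2 ^ m) (P 0) ⟩
      2 * 2 ^ m * (f m * P 0 + 0) ∎
    where
    open ≡-Reasoning
    B = prodLin (λ i → 2 * f i) m
    P : Poly
    P = prodLin f m
    l1 : ∀ a b → 1 * (2 * a * b + 0) ≡ 2 * a * (1 * b)
    l1 = solve-∀
    l2 : ∀ a c b → 2 * a * (c * b) ≡ 2 * c * (a * b + 0)
    l2 = solve-∀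
  prodLin-double f (suc m) (suc k) = begin
      2 * 2 ^ k * (2 * f m * B (suc k) + B k)
        ≡⟨ l1 (2 ^ k) (f m) (B (suc k)) (B k) ⟩
      2 * f m * (2 * 2 ^ k * B (suc k)) + 2 * (2 ^ k * B k)
        ≡⟨ cong₂ (λ a b → 2 * f m * a + 2 * b) (prodLin-double f m (suc k)) (prodLin-double f m k) ⟩
      2 * f m * (2 ^ m * P (suc k)) + 2 * (2 ^ m * P k)
        ≡⟨ l2 (2 ^ m) (f m) (P (suc k)) (P k) ⟩
      2 * 2 ^ m * (f m * P (suc k) + P k) ∎
    where
    open ≡-Reasoning
    B = prodLin (λ i → 2 * f i) m
    P : Poly
    P = prodLin f m
    l1 : ∀ a c x y → 2 * a * (2 * c * x + y) ≡ 2 * c * (2 * a * x) + 2 * (a * y)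
    l1 = solve-∀
    l2 : ∀ a c x y → 2 * c * (a * x) + 2 * (a * y) ≡ 2 * a * (c * x + y)
    l2 = solve-∀

-- Pairing linear factors whose constants add up to β:
--   (x + f)(x + g) = x² + βx + fg  when f + g = β.
-- If every pair has constant sum β and G(y) = ∏ (y + f_i g_i), then
--   ∏ (x + f_i)(x + g_i) = G(x²) + β·x·G'(x²) + β²·R(x)
-- for some R with natural coefficients; coefficientwise this is PairForm below.
module Pairing where

  open import Data.Nat
  open import Data.Nat.Properties
  open import Data.Product using (∃-syntax; _,_; proj₁; proj₂)
  open import Relation.Binary.PropositionalEquality
  open import Data.Nat.Tactic.RingSolver using (solve-∀)
  open TwoAdic using (dbl)
  open Poly

  quadMul : ℕ → ℕ → Poly → Poly
  quadMul β C p k = C * p k + β * shift p k + shift (shift p) k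

  linMul² : ∀ u u' p → linMul u (linMul u' p) ≐ quadMul (u + u') (u * u') p
  linMul² u u' p zero = lem u u' (p 0)
    where
    lem : ∀ u u' a → u * (u' * a + 0) + 0 ≡ u * u' * a + (u + u') * 0 + 0
    lem = solve-∀
  linMul² u u' p (suc k) = lem u u' (p (suc k)) (p k) (shift p k)
    where
    lem : ∀ u u' a b c → u * (u' * a + b) + (u' * b + c) ≡ u * u' * a + (u + u') * b + c
    lem = solve-∀

  -- spread h is the polynomial h(x²).
  spread : Poly → Poly
  spread h zero = h 0
  spread h (suc zero) = 0
  spread h (suc (suc k)) = spread (λ j → h (suc j)) k

  spread-even : ∀ h j → spread h (dbl j) ≡ h j
  spread-even h zero = refl
  spread-even h (suc j) = spread-even (λ j → h (suc j)) j

  spread-odd : ∀ h j → spread h (suc (dbl j)) ≡ 0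
  spread-odd h zero = refl
  spread-odd h (suc j) = spread-odd (λ j → h (suc j)) j

  record PairForm (β : ℕ) (q G R : Poly) : Set where
    field
      even-coeff : ∀ j → q (dbl j) ≡ G j + β * β * R (dbl j)
      odd-coeff  : ∀ j → q (suc (dbl j)) ≡ β * (suc j * G (suc j)) + β * β * R (suc (dbl j))

  -- The remainder after multiplying by x² + βx + C: besides the obvious terms,
  -- β²·x²·G'(x²) reappears as β² times the spread of j·G_j.
  nextRemainder : ℕ → ℕ → Poly → Poly → Poly
  nextRemainder β C G R k = quadMul β C R k + spread (λ j → j * G j) k

  module PairStep (β C : ℕ) {q G R : Poly} (form : PairForm β q G R) where
    open PairForm form
    open ≡-Reasoning
    R' : Poly
    R' = nextRemainder β C G R
    evenᶜ : ∀ j → quadMul β C q (dbl j) ≡ linMul C G j + β * β * R' (dbl j)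
    evenᶜ zero = trans (cong (λ z → C * z + β * 0 + 0) (even-coeff 0)) (lem β C (G 0) (R 0))
      where
      lem : ∀ β C g r → C * (g + β * β * r) + β * 0 + 0 ≡ (C * g + 0) + β * β * (C * r + β * 0 + 0 + 0 * g)
      lem = solve-∀
    evenᶜ (suc j) = begin
      C * q (dbl (suc j)) + β * q (suc (dbl j)) + q (dbl j)
        ≡⟨ cong₂ _+_ (cong₂ (λ a b → C * a + β * b) (even-coeff (suc j)) (odd-coeff j)) (even-coeff j) ⟩
      C * (G (suc j) + β * β * R (dbl (suc j))) + β * (β * (suc j * G (suc j)) + β * β * R (suc (dbl j)))
        + (G j + β * β * R (dbl j))
        ≡⟨ lem β C (G (suc j)) (G j) (R (dbl (suc j))) (R (suc (dbl j))) (R (dbl j)) (suc j) ⟩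
      C * G (suc j) + G j + β * β * (quadMul β C R (dbl (suc j)) + suc j * G (suc j))
        ≡⟨ cong (λ z → C * G (suc j) + G j + β * β * (quadMul β C R (dbl (suc j)) + z))
                (sym (spread-even (λ j → j * G j) (suc j))) ⟩
      linMul C G (suc j) + β * β * R' (dbl (suc j)) ∎
      where
      lem : ∀ β C gs g0 ra rb rc s → C * (gs + β * β * ra) + β * (β * (s * gs) + β * β * rb) + (g0 + β * β * rc)
         ≡ C * gs + g0 + β * β * (C * ra + β * rb + rc + s * gs)
      lem = solve-∀
    oddᶜ : ∀ j → quadMul β C q (suc (dbl j)) ≡ β * (suc j * linMul C G (suc j)) + β * β * R' (suc (dbl j))
    oddᶜ zero = begin
      C * q 1 + β * q 0 + 0
        ≡⟨ cong₂ (λ a b → C * a + β * b + 0) (odd-coeff 0) (even-coeff 0) ⟩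
      C * (β * (1 * G 1) + β * β * R 1) + β * (G 0 + β * β * R 0) + 0
        ≡⟨ lem β C (G 1) (G 0) (R 1) (R 0) ⟩
      β * (1 * linMul C G 1) + β * β * (quadMul β C R 1 + 0)
        ≡⟨ cong (λ z → β * (1 * linMul C G 1) + β * β * (quadMul β C R 1 + z)) (sym (spread-odd (λ j → j * G j) 0)) ⟩
      β * (1 * linMul C G 1) + β * β * R' 1 ∎
      where
      lem : ∀ β C g1 g0 r1 r0 → C * (β * (1 * g1) + β * β * r1) + β * (g0 + β * β * r0) + 0
                              ≡ β * (1 * (C * g1 + g0)) + β * β * (C * r1 + β * r0 + 0 + 0)
      lem = solve-∀
    oddᶜ (suc j) = begin
      C * q (suc (dbl (suc j))) + β * q (dbl (suc j)) + q (suc (dbl j))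
        ≡⟨ cong₂ _+_ (cong₂ (λ a b → C * a + β * b) (odd-coeff (suc j)) (even-coeff (suc j))) (odd-coeff j) ⟩
      C * (β * (suc (suc j) * G (suc (suc j))) + β * β * R (suc (dbl (suc j))))
        + β * (G (suc j) + β * β * R (dbl (suc j))) + (β * (suc j * G (suc j)) + β * β * R (suc (dbl j)))
        ≡⟨ lem β C (G (suc (suc j))) (G (suc j)) (R (suc (dbl (suc j)))) (R (dbl (suc j))) (R (suc (dbl j))) (suc j) ⟩
      β * (suc (suc j) * linMul C G (suc (suc j))) + β * β * (quadMul β C R (suc (dbl (suc j))) + 0)
        ≡⟨ cong (λ z → β * (suc (suc j) * linMul C G (suc (suc j))) + β * β * (quadMul β C R (suc (dbl (suc j))) + z))
                (sym (spread-odd (λ j → j * G j) (suc j))) ⟩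
      β * (suc (suc j) * linMul C G (suc (suc j))) + β * β * R' (suc (dbl (suc j))) ∎
      where
      lem : ∀ β C g2 g1 ra rb rc s → C * (β * (suc s * g2) + β * β * ra) + β * (g1 + β * β * rb) + (β * (s * g1) + β * β * rc)
        ≡ β * (suc s * (C * g2 + g1)) + β * β * (C * ra + β * rb + rc + 0)
      lem = solve-∀

  pairForm-step : ∀ β C {q G R} → PairForm β q G R →
    PairForm β (quadMul β C q) (linMul C G) (nextRemainder β C G R)
  pairForm-step β C form = record { even-coeff = PairStep.evenᶜ β C form ; odd-coeff = PairStep.oddᶜ β C form }

  pairing : ∀ β f g m → (∀ i → i < m → f i + g i ≡ β) →
    ∃[ R ] PairForm β (prodPair f g m) (prodLin (λ i → f i * g i) m) R
  pairing β f g zero h = (λ _ → 0) , record { even-coeff = evenᶜ ; odd-coeff = oddᶜ }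
    where
    evenᶜ : ∀ j → 𝟙 (dbl j) ≡ 𝟙 j + β * β * 0
    evenᶜ zero = sym (cong (1 +_) (*-zeroʳ (β * β)))
    evenᶜ (suc j) = sym (*-zeroʳ (β * β))
    oddᶜ : ∀ j → 𝟙 (suc (dbl j)) ≡ β * (suc j * 𝟙 (suc j)) + β * β * 0
    oddᶜ j = sym (cong₂ _+_ (trans (cong (β *_) (*-zeroʳ (suc j))) (*-zeroʳ β)) (*-zeroʳ (β * β)))
  pairing β f g (suc m) h = nextRemainder β C P R , record
    { even-coeff = λ j → trans (factor (dbl j)) (PairForm.even-coeff form j)
    ; odd-coeff  = λ j → trans (factor (suc (dbl j))) (PairForm.odd-coeff form j) }
    where
    C : ℕ
    C = f m * g m
    P : Poly
    P = prodLin (λ i → f i * g i) m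
    IH : ∃[ R ] PairForm β (prodPair f g m) P R
    IH = pairing β f g m (λ i p → h i (m≤n⇒m≤1+n p))
    R : Poly
    R = proj₁ IH
    form : PairForm β (quadMul β C (prodPair f g m)) (linMul C P) (nextRemainder β C P R)
    form = pairForm-step β C (proj₂ IH)
    factor : prodPair f g (suc m) ≐ quadMul β C (prodPair f g m)
    factor k = trans (linMul² (f m) (g m) (prodPair f g m) k)
                     (cong (λ b → quadMul b C (prodPair f g m) k) (h m ≤-refl))

-- Congruence of natural numbers modulo K, without subtraction: x ≡ y (mod K) is
-- witnessed by x + K·a = y + K·b. Congruent numbers share their valuation below K = 2^k.
module Congruence where

  open import Data.Nat
  open import Data.Nat.Properties
  open import Relation.Binary.PropositionalEquality
  open import Data.Nat.Tactic.RingSolver using (solve-∀)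
  open TwoAdic
  open Poly

  record ModEq (K x y : ℕ) : Set where
    constructor modEq
    field
      multipleˡ : ℕ
      multipleʳ : ℕ
      balance : x + K * multipleˡ ≡ y + K * multipleʳ

  ModEq-refl : ∀ {K x} → ModEq K x x
  ModEq-refl = modEq 0 0 refl

  ModEq-sym : ∀ {K x y} → ModEq K x y → ModEq K y x
  ModEq-sym (modEq a b p) = modEq b a (sym p)

  ModEq-+ : ∀ {K x x' y y'} → ModEq K x x' → ModEq K y y' → ModEq K (x + y) (x' + y')
  ModEq-+ {K} {x} {x'} {y} {y'} (modEq a b p) (modEq c d q) = modEq (a + c) (b + d)
    (trans (lem x y K a c) (trans (cong₂ _+_ p q) (sym (lem x' y' K b d))))
    where
    lem : ∀ x y K a c → x + y + K * (a + c) ≡ (x + K * a) + (y + K * c)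
    lem = solve-∀

  ModEq-* : ∀ {K x x' y y'} → ModEq K x x' → ModEq K y y' → ModEq K (x * y) (x' * y')
  ModEq-* {K} {x} {x'} {y} {y'} (modEq a b p) (modEq c d q) =
    modEq (a * y + x * c + K * a * c) (b * y' + x' * d + K * b * d)
      (trans (lem x y K a c) (trans (cong₂ _*_ p q) (sym (lem x' y' K b d))))
    where
    lem : ∀ x y K a c → x * y + K * (a * y + x * c + K * a * c) ≡ (x + K * a) * (y + K * c)
    lem = solve-∀

  ModEq-sum : ∀ {K} f g m → (∀ i → i < m → ModEq K (f i) (g i)) → ModEq K (sumTo f m) (sumTo g m)
  ModEq-sum f g zero h = ModEq-refl
  ModEq-sum f g (suc m) h = ModEq-+ (ModEq-sum f g m (λ i p → h i (m≤n⇒m≤1+n p))) (h m ≤-refl)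

  ModEq-conv : ∀ {K} p p' q q' → (∀ k → ModEq K (p k) (p' k)) → (∀ k → ModEq K (q k) (q' k)) →
    ∀ k → ModEq K (conv p q k) (conv p' q' k)
  ModEq-conv p p' q q' hp hq k = ModEq-sum _ _ (suc k) (λ i _ → ModEq-* (hp i) (hq (k ∸ i)))

  ModEq-prodLin : ∀ {K} f g m → (∀ i → i < m → ModEq K (f i) (g i)) →
    ∀ k → ModEq K (prodLin f m k) (prodLin g m k)
  ModEq-prodLin f g zero h k = ModEq-refl
  ModEq-prodLin {K} f g (suc m) h = coeff
    where
    IH : ∀ k → ModEq K (prodLin f m k) (prodLin g m k)
    IH = ModEq-prodLin f g m (λ i p → h i (m≤n⇒m≤1+n p))
    coeff : ∀ k → ModEq K (prodLin f (suc m) k) (prodLin g (suc m) k)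
    coeff zero = ModEq-+ (ModEq-* (h m ≤-refl) (IH 0)) ModEq-refl
    coeff (suc k) = ModEq-+ (ModEq-* (h m ≤-refl) (IH (suc k))) (IH k)

  ‖-ModEq : ∀ {k e x y} → ModEq (2 ^ k) x y → e < k → 2^ e ‖ x → 2^ e ‖ y
  ‖-ModEq {k} {e} (modEq a b p) e<k v =
    ‖-+-cancel-higher (subst (2^ e ‖_) p (‖-+-higher v (pow∣-weaken e<k (pow∣-pow* k a))))
                      (pow∣-weaken e<k (pow∣-pow* k b))

-- If G is
-- moreover monic of degree 2^m, then G² has the pattern at level m + 1. Indeed
-- (G²)_c = Σ_{a+b=c} G_a G_b is twice the sum of the terms with a < b, plus G_q² when
-- c = 2q; in the half sum exactly one term (a = max(0, c - 2^m)) has valuation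
-- m - v₂(c) and all others are divisible by a higher power of two, while the
-- middle square is divisible by 2^(m - v₂(c) + 2).
module Squaring where

  open import Data.Nat
  open import Data.Nat.Properties
  open import Data.Sum using (inj₁; inj₂)
  open import Data.Empty using (⊥-elim)
  open import Relation.Binary.Definitions using (tri<; tri≈; tri>)
  open import Relation.Binary.PropositionalEquality
  open import Data.Nat.Tactic.RingSolver using (solve-∀)
  open import Defs using (v2)
  open TwoAdic
  open Poly

  -- Sums of palindromic sequences T a = T (c - a) of even and odd length c + 1: the second half
  -- of the sum, read backwards, repeats the first half.
  sum-palindrome-odd : ∀ T q → (∀ a → a ≤ suc (2 * q) → T a ≡ T (suc (2 * q) ∸ a)) →
    sumTo T (suc (suc (2 * q))) ≡ 2 * sumTo T (suc q)
  sum-palindrome-odd T q h = begin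
      sumTo T (suc (suc (2 * q)))                                          ≡⟨ cong (sumTo T) (l1 q) ⟩
      sumTo T (suc q + suc q)                                              ≡⟨ sum-split T (suc q) (suc q) ⟩
      sumTo T (suc q) + sumTo (λ i → T (suc q + i)) (suc q)                ≡⟨ cong (sumTo T (suc q) +_) (sum-rev _ (suc q)) ⟩
      sumTo T (suc q) + sumTo (λ i → T (suc q + (suc q ∸ suc i))) (suc q)  ≡⟨ cong (sumTo T (suc q) +_) (sum-ext (suc q) mirror) ⟩
      sumTo T (suc q) + sumTo T (suc q)                                    ≡⟨ sym (twice (sumTo T (suc q))) ⟩
      2 * sumTo T (suc q)                                                  ∎
    where
    open ≡-Reasoning
    c : ℕ
    c = suc (2 * q)
    l1 : ∀ q → suc (suc (2 * q)) ≡ suc q + suc q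
    l1 = solve-∀
    l2 : ∀ q → suc (2 * q) ≡ suc q + q
    l2 = solve-∀
    mirror : ∀ i → i < suc q → T (suc q + (q ∸ i)) ≡ T i
    mirror i i<q = trans (cong T index) (trans (h (c ∸ i) (m∸n≤m c i)) (cong T (m∸[m∸n]≡n i≤c)))
      where
      i≤q : i ≤ q
      i≤q = s≤s⁻¹ i<q
      i≤c : i ≤ c
      i≤c = ≤-trans i≤q (≤-trans (m≤m+n q (q + 0)) (n≤1+n _))
      index : suc q + (q ∸ i) ≡ c ∸ i
      index = sym (trans (cong (_∸ i) (l2 q)) (+-∸-assoc (suc q) i≤q))

  sum-palindrome-even : ∀ T q → (∀ a → a ≤ 2 * q → T a ≡ T (2 * q ∸ a)) →
    sumTo T (suc (2 * q)) ≡ 2 * sumTo T q + T q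
  sum-palindrome-even T q h = begin
      sumTo T (suc (2 * q))                                        ≡⟨ cong (sumTo T) (l1 q) ⟩
      sumTo T (q + suc q)                                          ≡⟨ sum-split T q (suc q) ⟩
      sumTo T q + sumTo (λ i → T (q + i)) (suc q)                  ≡⟨ cong (sumTo T q +_) (sum-front _ q) ⟩
      sumTo T q + (T (q + 0) + sumTo (λ i → T (q + suc i)) q)      ≡⟨ cong (λ z → sumTo T q + (T z + sumTo (λ i → T (q + suc i)) q)) (+-identityʳ q) ⟩
      sumTo T q + (T q + sumTo (λ i → T (q + suc i)) q)            ≡⟨ cong (λ z → sumTo T q + (T q + z)) (sum-rev _ q) ⟩
      sumTo T q + (T q + sumTo (λ i → T (q + suc (q ∸ suc i))) q)  ≡⟨ cong (λ z → sumTo T q + (T q + z)) (sum-ext q mirror) ⟩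
      sumTo T q + (T q + sumTo T q)                                ≡⟨ l2 (sumTo T q) (T q) ⟩
      2 * sumTo T q + T q                                          ∎
    where
    open ≡-Reasoning
    l1 : ∀ q → suc (2 * q) ≡ q + suc q
    l1 = solve-∀
    l2 : ∀ x y → x + (y + x) ≡ 2 * x + y
    l2 = solve-∀
    mirror : ∀ i → i < q → T (q + suc (q ∸ suc i)) ≡ T i
    mirror i i<q = trans (cong T index) (trans (h (2 * q ∸ i) (m∸n≤m (2 * q) i)) (cong T (m∸[m∸n]≡n i≤2q)))
      where
      i≤2q : i ≤ 2 * q
      i≤2q = ≤-trans (<⇒≤ i<q) (m≤m+n q (q + 0))
      index : q + suc (q ∸ suc i) ≡ 2 * q ∸ i
      index = trans (cong (q +_) (sym (+-∸-assoc 1 i<q)))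
                    (trans (sym (+-∸-assoc q (<⇒≤ i<q))) (cong (_∸ i) (sym (twice q))))

  ∸-pair-bound : ∀ m x y z → x < m → y < m → x ⊓ y ≤ z → suc (m ∸ z) ≤ (m ∸ x) + (m ∸ y)
  ∸-pair-bound m x y z px py h with ≤-total x y
  ... | inj₁ x≤y = subst (suc (m ∸ z) ≤_) (+-comm (m ∸ y) (m ∸ x))
        (+-mono-≤ (m<n⇒0<n∸m py) (∸-monoʳ-≤ m (subst (_≤ z) (m≤n⇒m⊓n≡m x≤y) h)))
  ... | inj₂ y≤x = +-mono-≤ (m<n⇒0<n∸m px) (∸-monoʳ-≤ m (subst (_≤ z) (m≥n⇒m⊓n≡n y≤x) h))

  ∸-mid-bound : ∀ m v → v < m → suc (suc (m ∸ suc v)) ≤ (m ∸ v) + (m ∸ v)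
  ∸-mid-bound (suc m) zero _ = s≤s (m≤n+m (suc m) m)
  ∸-mid-bound (suc m) (suc v) (s≤s p) = ∸-mid-bound m v p

  record Pattern (m : ℕ) (G : Poly) : Set where
    field
      constant-odd : 2^ 0 ‖ G 0
      inner : ∀ j → 1 ≤ j → j < 2 ^ m → 2^ m ∸ v2 j ‖ G j

  module _ (m : ℕ) (G : Poly) (G-pattern : Pattern m G)
           (monic : G (2 ^ m) ≡ 1) (vanish : ∀ j → 2 ^ m < j → G j ≡ 0) where

    open Pattern G-pattern

    private
      M : ℕ
      M = 2 ^ m

    module Coefficient (c : ℕ) (c≥1 : 1 ≤ c) (c<2M : c < 2 * M) where

      T : ℕ → ℕ
      T a = G a * G (c ∸ a)

      T-sym : ∀ a → a ≤ c → T a ≡ T (c ∸ a)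
      T-sym a a≤c = trans (*-comm (G a) (G (c ∸ a))) (cong (λ z → G (c ∸ a) * G z) (sym (m∸[m∸n]≡n a≤c)))

      e : ℕ
      e = m ∸ v2 c

      a₀ : ℕ
      a₀ = c ∸ M

      half<M : ∀ {q} → 2 * q ≤ c → q < M
      half<M 2q≤c = *-cancelˡ-< 2 _ _ (≤-<-trans 2q≤c c<2M)

      dominant : 2^ e ‖ T a₀
      dominant with <-cmp c M
      ... | tri< c<M _ _ = subst (λ z → 2^ e ‖ T z) (sym (m≤n⇒m∸n≡0 (<⇒≤ c<M))) (‖-* constant-odd (inner c c≥1 c<M))
      ... | tri≈ _ c≡M _ = subst₂ 2^_‖_ e≡0 Ta₀≡ constant-odd
        where
        e≡0 : 0 ≡ e
        e≡0 = sym (trans (cong (λ z → m ∸ v2 z) c≡M) (trans (cong (m ∸_) (v2-pow m)) (n∸n≡0 m)))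
        Ta₀≡ : G 0 ≡ T a₀
        Ta₀≡ = sym (trans (cong T (trans (cong (_∸ M) c≡M) (n∸n≡0 M)))
                          (trans (cong (λ z → G 0 * G z) c≡M) (trans (cong (G 0 *_) monic) (*-identityʳ (G 0)))))
      ... | tri> _ _ M<c = subst₂ 2^_‖_ (cong (m ∸_) v2-d≡v2-c) (sym Ta₀≡) (inner a₀ a₀≥1 a₀<M)
        where
        a₀≥1 : 1 ≤ a₀
        a₀≥1 = m<n⇒0<n∸m M<c
        a₀<M : a₀ < M
        a₀<M = m<n+o⇒m∸n<o c M {{m^n≢0 2 m}} (subst (c <_) (twice M) c<2M)
        Ta₀≡ : T a₀ ≡ G a₀
        Ta₀≡ = trans (cong (λ z → G a₀ * G z) (m∸[m∸n]≡n (<⇒≤ M<c))) (trans (cong (G a₀ *_) monic) (*-identityʳ _))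
        -- c = a₀ + 2^m with v₂(a₀) < m, so v₂(c) = v₂(a₀).
        v2-d≡v2-c : v2 a₀ ≡ v2 c
        v2-d≡v2-c = sym (v2-exact (subst (2^ v2 a₀ ‖_) (m∸n+n≡m (<⇒≤ M<c))
                      (‖-+-higher (v2-correct a₀ a₀≥1) (pow∣pow (v2<n a₀ m a₀≥1 a₀<M)))))

      negligible : ∀ a → a + a < c → a ≢ a₀ → 2^ suc e ∣ T a
      negligible a 2a<c a≢a₀ with <-cmp (c ∸ a) M
      ... | tri> _ _ M<b = subst (2^ suc e ∣_) (sym (trans (cong (G a *_) (vanish (c ∸ a) M<b)) (*-zeroʳ (G a)))) (pow∣0 _)
      ... | tri≈ _ b≡M _ = ⊥-elim (a≢a₀ (trans (sym (m∸[m∸n]≡n a≤c)) (cong (c ∸_) b≡M)))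
        where
        a≤c : a ≤ c
        a≤c = ≤-trans (m≤m+n a a) (<⇒≤ 2a<c)
      ... | tri< b<M _ _ = pow∣-weaken bound (‖⇒∣ (‖-* (inner a a≥1 a<M) (inner b b≥1 b<M)))
        where
        b = c ∸ a
        a≤c : a ≤ c
        a≤c = ≤-trans (m≤m+n a a) (<⇒≤ 2a<c)
        a<b : a < b
        a<b = m+n≤o⇒m≤o∸n (suc a) 2a<c
        a<M : a < M
        a<M = <-trans a<b b<M
        a≥1 : 1 ≤ a
        a≥1 = n≢0⇒n>0 (λ a≡0 → a≢a₀ (trans a≡0 (sym (m≤n⇒m∸n≡0 (<⇒≤ (subst (_< M) (cong (c ∸_) a≡0) b<M))))))
        b≥1 : 1 ≤ b
        b≥1 = <-≤-trans a≥1 (<⇒≤ a<b)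
        -- v₂(c) = v₂(a + b) ≥ min (v₂ a) (v₂ b).
        bound : suc e ≤ (m ∸ v2 a) + (m ∸ v2 b)
        bound = ∸-pair-bound m (v2 a) (v2 b) (v2 c) (v2<n a m a≥1 a<M) (v2<n b m b≥1 b<M)
                  (subst (λ z → v2 a ⊓ v2 b ≤ v2 z) (m+[n∸m]≡n a≤c) (v2-+-min a b a≥1 b≥1))

      half-sum : ∀ h → a₀ < h → (∀ a → a < h → a + a < c) → 2^ e ‖ sumTo T h
      half-sum h a₀<h small = sum-‖-dominant T h a₀ a₀<h dominant (λ a a<h ne → negligible a (small a a<h) ne)

      -- For c = 2q the middle term G_q² has valuation 2(m - v₂ q) ≥ e + 2.
      middle : ∀ q → c ≡ 2 * q → 2^ suc (suc e) ∣ T q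
      middle q c≡2q = pow∣-weaken bound (‖⇒∣ (subst (2^ (m ∸ v2 q) + (m ∸ v2 q) ‖_) Tq≡ (‖-* vq vq)))
        where
        q≥1 : 1 ≤ q
        q≥1 = n≢0⇒n>0 (λ q≡0 → <⇒≱ c≥1 (≤-reflexive (trans c≡2q (cong (2 *_) q≡0))))
        q<M : q < M
        q<M = half<M (≤-reflexive (sym c≡2q))
        vq : 2^ m ∸ v2 q ‖ G q
        vq = inner q q≥1 q<M
        Tq≡ : G q * G q ≡ T q
        Tq≡ = cong (λ z → G q * G z) (sym (trans (cong (_∸ q) (trans c≡2q (twice q))) (m+n∸n≡m q q)))
        bound : suc (suc e) ≤ (m ∸ v2 q) + (m ∸ v2 q)
        bound = subst (λ z → suc (suc (m ∸ z)) ≤ (m ∸ v2 q) + (m ∸ v2 q))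
                      (sym (trans (cong v2 c≡2q) (v2-double q q≥1))) (∸-mid-bound m (v2 q) (v2<n q m q≥1 q<M))

      coefficient : 2^ suc m ∸ v2 c ‖ conv G G c
      coefficient = subst (2^_‖ conv G G c) (sym (+-∸-assoc 1 (s≤s⁻¹ (v2<n c (suc m) c≥1 c<2M)))) (by-parity (parity-of c))
        where
        by-parity : Parity c → 2^ suc e ‖ conv G G c
        by-parity (odd q c≡) = subst (2^ suc e ‖_) (sym split) (‖-double (half-sum (suc q) a₀<h small))
          where
          split : conv G G c ≡ 2 * sumTo T (suc q)
          split = trans (cong (λ z → sumTo T (suc z)) c≡)
                        (sum-palindrome-odd T q (λ a p → subst (λ z → T a ≡ T (z ∸ a)) c≡ (T-sym a (subst (a ≤_) (sym c≡) p))))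
          q<M : q < M
          q<M = half<M (subst (2 * q ≤_) (sym c≡) (n≤1+n _))
          a₀<h : a₀ < suc q
          a₀<h = s≤s (m≤n+o⇒m∸n≤o c M (subst (_≤ M + q) (sym c≡) (subst (_≤ M + q) (cong suc (sym (twice q))) (+-monoˡ-≤ q q<M))))
          small : ∀ a → a < suc q → a + a < c
          small a a≤q = subst (a + a <_) (sym c≡) (s≤s (subst (a + a ≤_) (sym (twice q)) (+-mono-≤ (s≤s⁻¹ a≤q) (s≤s⁻¹ a≤q))))
        by-parity (even q c≡) = subst (2^ suc e ‖_) (sym split) (‖-+-higher (‖-double (half-sum q a₀<h small)) (middle q c≡))
          where
          split : conv G G c ≡ 2 * sumTo T q + T q
          split = trans (cong (λ z → sumTo T (suc z)) c≡)
                        (sum-palindrome-even T q (λ a p → subst (λ z → T a ≡ T (z ∸ a)) c≡ (T-sym a (subst (a ≤_) (sym c≡) p))))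
          q≥1 : 1 ≤ q
          q≥1 = n≢0⇒n>0 (λ q≡0 → <⇒≱ c≥1 (≤-reflexive (trans c≡ (cong (2 *_) q≡0))))
          q<M : q < M
          q<M = half<M (≤-reflexive (sym c≡))
          a₀<h : a₀ < q
          a₀<h = m<n+o⇒m∸n<o c M {{>-nonZero q≥1}} (subst (_< M + q) (sym (trans c≡ (twice q))) (+-monoˡ-< q q<M))
          small : ∀ a → a < q → a + a < c
          small a a<q = subst (a + a <_) (sym (trans c≡ (twice q))) (+-mono-< a<q a<q)

    square-pattern : Pattern (suc m) (conv G G)
    square-pattern = record
      { constant-odd = ‖-* constant-odd constant-odd
      ; inner = λ c c≥1 c<2M → Coefficient.coefficient c c≥1 c<2M }

-- The auxiliary polynomials G_m(y) = ∏_{i<2^m} (y + (2i + 1)(2^(m+2) - 2i - 1)).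
-- Their constants are the products of the pairs of odd numbers 2i + 1 and 2^(m+2) - 2i - 1,
-- which sum to 2^(m+2). Modulo 2^(m+2) the constants of G_{m+1} repeat those of G_m twice,
-- so G_{m+1} ≡ G_m² coefficientwise, and by induction with the squaring lemma every G_m
-- has the 2-adic pattern at level m.
module OddPairs where

  open import Data.Nat
  open import Data.Nat.Properties
  open import Data.Empty using (⊥-elim)
  open import Relation.Binary.PropositionalEquality
  open import Data.Nat.Tactic.RingSolver using (solve-∀)
  open import Defs using (v2)
  open TwoAdic
  open Poly
  open Congruence
  open Squaring

  pairConst : ℕ → ℕ → ℕ
  pairConst m i = suc (2 * i) * suc (2 * (2 ^ m + (2 ^ m ∸ suc i)))

  G : ℕ → Poly
  G m = prodLin (pairConst m) (2 ^ m)

  G-monic : ∀ m → G m (2 ^ m) ≡ 1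
  G-monic m = prodLin-lead (pairConst m) (2 ^ m)

  G-vanish : ∀ m j → 2 ^ m < j → G m j ≡ 0
  G-vanish m j p = prodLin-deg (pairConst m) (2 ^ m) j p

  -- The constants of the lower half of G_{m+1} agree with those of G_m modulo 2^(m+2)
  -- (stated for M = 2^m = i + d + 1, to avoid subtraction).
  pairConst-lower : ∀ M i d → M ≡ suc (i + d) →
    ModEq (2 * (2 * M)) (suc (2 * i) * suc (2 * (2 * M + (2 * M ∸ suc i)))) (suc (2 * i) * suc (2 * (M + (M ∸ suc i))))
  pairConst-lower M i d refl = modEq 0 (suc (2 * i)) (begin
      suc (2 * i) * suc (2 * (2 * M + (2 * M ∸ suc i))) + 2 * (2 * M) * 0
        ≡⟨ cong (λ z → suc (2 * i) * suc (2 * (2 * M + z)) + 2 * (2 * M) * 0) s1 ⟩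
      suc (2 * i) * suc (2 * (2 * M + (M + d))) + 2 * (2 * M) * 0
        ≡⟨ lem i d ⟩
      suc (2 * i) * suc (2 * (M + d)) + 2 * (2 * M) * suc (2 * i)
        ≡⟨ cong (λ z → suc (2 * i) * suc (2 * (M + z)) + 2 * (2 * M) * suc (2 * i)) (sym (m+n∸m≡n i d)) ⟩
      suc (2 * i) * suc (2 * (M + (M ∸ suc i))) + 2 * (2 * M) * suc (2 * i) ∎)
    where
    open ≡-Reasoning
    s1 : 2 * suc (i + d) ∸ suc i ≡ suc (i + d) + d
    s1 = trans (cong (_∸ suc i) (l i d)) (m+n∸m≡n (suc i) _)
      where
      l : ∀ i d → 2 * suc (i + d) ≡ suc i + (suc (i + d) + d)
      l = solve-∀
    lem : ∀ i d → suc (2 * i) * suc (2 * (2 * suc (i + d) + (suc (i + d) + d))) + 2 * (2 * suc (i + d)) * 0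
        ≡ suc (2 * i) * suc (2 * (suc (i + d) + d)) + 2 * (2 * suc (i + d)) * suc (2 * i)
    lem = solve-∀

  pairConst-upper : ∀ M i d → M ≡ suc (i + d) →
    ModEq (2 * (2 * M)) (suc (2 * (M + i)) * suc (2 * (2 * M + (2 * M ∸ suc (M + i))))) (suc (2 * i) * suc (2 * (M + (M ∸ suc i))))
  pairConst-upper M i d refl = modEq 0 (3 * M) (begin
      suc (2 * (M + i)) * suc (2 * (2 * M + (2 * M ∸ suc (M + i)))) + 2 * (2 * M) * 0
        ≡⟨ cong (λ z → suc (2 * (M + i)) * suc (2 * (2 * M + z)) + 2 * (2 * M) * 0) s2 ⟩
      suc (2 * (M + i)) * suc (2 * (2 * M + d)) + 2 * (2 * M) * 0
        ≡⟨ lem i d ⟩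
      suc (2 * i) * suc (2 * (M + d)) + 2 * (2 * M) * (3 * M)
        ≡⟨ cong (λ z → suc (2 * i) * suc (2 * (M + z)) + 2 * (2 * M) * (3 * M)) (sym (m+n∸m≡n i d)) ⟩
      suc (2 * i) * suc (2 * (M + (M ∸ suc i))) + 2 * (2 * M) * (3 * M) ∎)
    where
    open ≡-Reasoning
    s2 : 2 * suc (i + d) ∸ suc (suc (i + d) + i) ≡ d
    s2 = trans (cong (_∸ suc (suc (i + d) + i)) (l i d)) (m+n∸m≡n (suc (suc (i + d) + i)) d)
      where
      l : ∀ i d → 2 * suc (i + d) ≡ suc (suc (i + d) + i) + d
      l = solve-∀
    lem : ∀ i d → suc (2 * (suc (i + d) + i)) * suc (2 * (2 * suc (i + d) + d)) + 2 * (2 * suc (i + d)) * 0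
        ≡ suc (2 * i) * suc (2 * (suc (i + d) + d)) + 2 * (2 * suc (i + d)) * (3 * suc (i + d))
    lem = solve-∀

  G-square-cong : ∀ m k → ModEq (2 ^ suc (suc m)) (G (suc m) k) (conv (G m) (G m) k)
  G-square-cong m k = subst (λ z → ModEq (2 ^ suc (suc m)) z (conv (G m) (G m) k)) (sym split)
      (ModEq-conv _ _ _ _ (ModEq-prodLin _ _ M (λ i p → by-gap p (pairConst-lower M i)))
                          (ModEq-prodLin _ _ M (λ i p → by-gap p (pairConst-upper M i))) k)
    where
    M : ℕ
    M = 2 ^ m
    split : G (suc m) k ≡ conv (prodLin (pairConst (suc m)) M) (prodLin (λ i → pairConst (suc m) (M + i)) M) k
    split = trans (cong (λ z → prodLin (pairConst (suc m)) z k) (cong (M +_) (+-identityʳ M)))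
                  (prodLin-split (pairConst (suc m)) M M k)
    by-gap : ∀ {i} {P : ℕ → Set} → i < M → (∀ d → M ≡ suc (i + d) → P d) → P (M ∸ suc i)
    by-gap {i} i<M f = f (M ∸ suc i) (sym (m+[n∸m]≡n i<M))

  G-pattern : ∀ m → Pattern m (G m)
  G-pattern zero = record { constant-odd = ‖-odd 1 ; inner = λ j j≥1 j<1 → ⊥-elim (<⇒≱ j<1 j≥1) }
  G-pattern (suc m) = record
    { constant-odd = ‖-ModEq {suc (suc m)} (ModEq-sym (G-square-cong m 0)) (s≤s z≤n) constant-odd
    ; inner = λ j j≥1 j<2M → ‖-ModEq {suc (suc m)} (ModEq-sym (G-square-cong m j)) (s≤s (m∸n≤m (suc m) (v2 j))) (inner j j≥1 j<2M)
    }
    where open Pattern (square-pattern m (G m) (G-pattern m) (G-monic m) (G-vanish m))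

-- Moreover νA n t is
-- the valuation (for odd t only a lower bound) of the coefficient of x^t in ∏_{i<N} (x + 2i + 1),
-- and νB n j = (N - j) + ν n j that of x^j in ∏_{i<N} (x + 2i) = 2^N ∏_{i<N} (x/2 + i).
module ValuationFormula where

  open import Data.Nat
  open import Data.Nat.Properties
  open import Data.Empty using (⊥-elim)
  open import Relation.Nullary using (yes; no)
  open import Relation.Binary.PropositionalEquality
  open import Data.Nat.Tactic.RingSolver using (solve-∀)
  open import Defs using (v2)
  open TwoAdic

  νhigh : ℕ → ℕ → ℕ
  νhigh n r with parity-of r
  ... | even _ _ = n ∸ v2 r
  ... | odd _ _ = (n + n) ∸ v2 (suc r)

  ν : ℕ → ℕ → ℕ
  ν zero k = 0
  ν (suc n) k with k ≤? 2 ^ n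
  ... | yes _ = (2 ^ n ∸ k) + ν n k
  ... | no _ = νhigh n (k ∸ 2 ^ n)

  νA : ℕ → ℕ → ℕ
  νA n zero = 0
  νA n (suc t) with parity-of (suc t)
  ... | even _ _ = n ∸ v2 (suc t)
  ... | odd _ _ = n + n

  νB : ℕ → ℕ → ℕ
  νB n j = (2 ^ n ∸ j) + ν n j

  ν-low : ∀ n k → k ≤ 2 ^ n → ν (suc n) k ≡ (2 ^ n ∸ k) + ν n k
  ν-low n k p with k ≤? 2 ^ n
  ... | yes _ = refl
  ... | no q = ⊥-elim (q p)

  ν-high : ∀ n k → 2 ^ n < k → ν (suc n) k ≡ νhigh n (k ∸ 2 ^ n)
  ν-high n k p with k ≤? 2 ^ n
  ... | yes q = ⊥-elim (<⇒≱ p q)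
  ... | no _ = refl

  νhigh-even : ∀ n r h → r ≡ 2 * h → νhigh n r ≡ n ∸ v2 r
  νhigh-even n r h e with parity-of r
  ... | even _ _ = refl
  ... | odd k p = ⊥-elim (even∧odd⇒⊥ h k e p)

  νhigh-odd : ∀ n r h → r ≡ suc (2 * h) → νhigh n r ≡ (n + n) ∸ v2 (suc r)
  νhigh-odd n r h e with parity-of r
  ... | even k p = ⊥-elim (even∧odd⇒⊥ k h p e)
  ... | odd _ _ = refl

  νA-even : ∀ n t h → 1 ≤ t → t ≡ 2 * h → νA n t ≡ n ∸ v2 t
  νA-even n (suc t) h _ e with parity-of (suc t)
  ... | even _ _ = refl
  ... | odd k p = ⊥-elim (even∧odd⇒⊥ h k e p)

  νA-odd : ∀ n t h → t ≡ suc (2 * h) → νA n t ≡ n + n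
  νA-odd n zero h ()
  νA-odd n (suc t) h e with parity-of (suc t)
  ... | even k p = ⊥-elim (even∧odd⇒⊥ k h p e)
  ... | odd _ _ = refl

  v2-even≥1 : ∀ r h → 1 ≤ r → r ≡ 2 * h → 1 ≤ v2 r
  v2-even≥1 r zero p e = ⊥-elim (<⇒≱ p (≤-reflexive e))
  v2-even≥1 r (suc h) p e = subst (1 ≤_) (sym (trans (cong v2 e) (v2-double (suc h) (s≤s z≤n)))) (s≤s z≤n)

  v2[2h+2]≥1 : ∀ h → 1 ≤ v2 (suc (suc (2 * h)))
  v2[2h+2]≥1 h = v2-even≥1 _ (suc h) (s≤s z≤n) (l h)
    where
    l : ∀ h → suc (suc (2 * h)) ≡ 2 * suc h
    l = solve-∀

  v2<pow∸ : ∀ n r → 1 ≤ r → r < 2 ^ n → suc (v2 r) ≤ 2 ^ n ∸ r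
  v2<pow∸ n r p q = ≤-trans (n<2^n (v2 r)) (pow∣⇒≤ dv pos)
    where
    dv : 2^ v2 r ∣ 2 ^ n ∸ r
    dv = pow∣-+-cancel (subst (2^ v2 r ∣_) (sym (m+[n∸m]≡n (<⇒≤ q))) (pow∣pow (<⇒≤ (v2<n r n p q)))) (‖⇒∣ (v2-correct r p))
    pos : 0 < 2 ^ n ∸ r
    pos = m<n⇒0<n∸m q

  n<t+νA : ∀ n t → 1 ≤ t → suc n ≤ t + νA n t
  n<t+νA n t p = go (parity-of t)
    where
    go : Parity t → suc n ≤ t + νA n t
    go (odd h e) = subst (λ z → suc n ≤ t + z) (sym (νA-odd n t h e)) (≤-trans (s≤s (m≤n+m n n)) (+-monoˡ-≤ (n + n) p))
    go (even h e) with v2 t ≤? n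
    ... | yes q = subst (λ z → suc n ≤ t + z) (sym (νA-even n t h p e))
                   (subst (suc n ≤_) (+-comm (n ∸ v2 t) t) (subst (_≤ (n ∸ v2 t) + t) (trans (+-suc (n ∸ v2 t) (v2 t)) (cong suc (m∸n+n≡m q))) (+-monoʳ-≤ (n ∸ v2 t) (v2<self t p))))
    ... | no q = subst (λ z → suc n ≤ t + z) (sym (νA-even n t h p e)) (≤-trans (≤-trans (s≤s (<⇒≤ (≰⇒> q))) (v2<self t p)) (m≤m+n t _))

  νA-mono : ∀ n t → νA n t ≤ νA (suc n) t
  νA-mono n zero = z≤n
  νA-mono n (suc t) with parity-of (suc t)
  ... | even _ _ = ∸-monoˡ-≤ (v2 (suc t)) (n≤1+n n)
  ... | odd _ _ = +-mono-≤ (n≤1+n n) (n≤1+n n)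

  νhigh-ub : ∀ n r → 1 ≤ r → νhigh n r ≤ (n + n) ∸ 1
  νhigh-ub n r pr = go (parity-of r)
    where
    go : Parity r → νhigh n r ≤ (n + n) ∸ 1
    go (odd h e) = subst (λ z → z ≤ (n + n) ∸ 1) (sym (νhigh-odd n r h e)) (∸-monoʳ-≤ (n + n) (subst (λ z → 1 ≤ v2 (suc z)) (sym e) (v2[2h+2]≥1 h)))
    go (even h e) = subst (λ z → z ≤ (n + n) ∸ 1) (sym (νhigh-even n r h e)) (≤-trans (∸-monoʳ-≤ n (v2-even≥1 r h pr e)) (∸-monoˡ-≤ 1 (m≤m+n n n)))

  νhigh-even-ub : ∀ n r h → 1 ≤ r → r ≡ 2 * h → νhigh n r ≤ n ∸ 1
  νhigh-even-ub n r h pr e = subst (_≤ n ∸ 1) (sym (νhigh-even n r h e)) (∸-monoʳ-≤ n (v2-even≥1 r h pr e))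

  νhigh-odd-lb : ∀ n r h → r ≡ suc (2 * h) → suc r ≤ 2 ^ n → n ≤ νhigh n r
  νhigh-odd-lb n r h e p = subst (n ≤_) (sym (νhigh-odd n r h e))
     (m+n≤o⇒m≤o∸n n (+-monoʳ-≤ n (v2≤n (suc r) n (s≤s z≤n) p)))

  2≤2^[1+n] : ∀ n → 2 ≤ 2 ^ suc n
  2≤2^[1+n] n = *-monoʳ-≤ 2 (m^n>0 2 n)

  2n≤2^n : ∀ n → 1 ≤ n → n + n ≤ 2 ^ n
  2n≤2^n (suc zero) _ = ≤-refl
  2n≤2^n (suc (suc n)) _ = subst (_≤ 2 ^ suc (suc n)) (sym (l n))
      (subst (suc n + suc n + 2 ≤_) (sym (l2 (2 ^ suc n))) (+-mono-≤ (2n≤2^n (suc n) (s≤s z≤n)) (2≤2^[1+n] n)))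
    where
    l : ∀ n → suc (suc n) + suc (suc n) ≡ suc n + suc n + 2
    l = solve-∀
    l2 : ∀ x → 2 * x ≡ x + x
    l2 = solve-∀

  3n+1≤2^[1+n] : ∀ n → 1 ≤ n → 3 * n + 1 ≤ 2 * 2 ^ n
  3n+1≤2^[1+n] (suc zero) _ = ≤-refl
  3n+1≤2^[1+n] (suc (suc n)) _ = subst (_≤ 2 * 2 ^ suc (suc n)) (sym (l n))
      (subst (3 * suc n + 1 + 3 ≤_) (sym (l2 (2 ^ suc n))) (+-mono-≤ (3n+1≤2^[1+n] (suc n) (s≤s z≤n)) (≤-trans (s≤s (s≤s (s≤s z≤n))) (*-monoʳ-≤ 2 (2≤2^[1+n] n)))))
    where
    l : ∀ n → 3 * suc (suc n) + 1 ≡ 3 * suc n + 1 + 3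
    l = solve-∀
    l2 : ∀ x → 2 * (2 * x) ≡ 2 * x + 2 * x
    l2 = solve-∀

  ∸-∸-swap : ∀ N k t → t ≤ k → k ≤ N → N ∸ (k ∸ t) ≡ (N ∸ k) + t
  ∸-∸-swap N k t p q = sym (begin
      (N ∸ k) + t ≡⟨ sym (m+n∸n≡m ((N ∸ k) + t) (k ∸ t)) ⟩
      (N ∸ k) + t + (k ∸ t) ∸ (k ∸ t) ≡⟨ cong (_∸ (k ∸ t)) (trans (+-assoc (N ∸ k) t (k ∸ t)) (trans (cong ((N ∸ k) +_) (m+[n∸m]≡n p)) (m∸n+n≡m q))) ⟩
      N ∸ (k ∸ t) ∎)
    where open ≡-Reasoning

  ν-top : ∀ m → ν (suc m) (2 ^ suc m) ≡ 0
  ν-top zero = refl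
  ν-top (suc m) = begin
    ν (suc (suc m)) (2 * N)   ≡⟨ ν-high (suc m) (2 * N) N<2N ⟩
    νhigh (suc m) (2 * N ∸ N) ≡⟨ cong (νhigh (suc m)) 2N∸N≡N ⟩
    νhigh (suc m) N           ≡⟨ νhigh-even (suc m) N (2 ^ m) refl ⟩
    suc m ∸ v2 N              ≡⟨ cong (suc m ∸_) (v2-pow (suc m)) ⟩
    suc m ∸ suc m             ≡⟨ n∸n≡0 (suc m) ⟩
    0                         ∎
    where
    open ≡-Reasoning
    N : ℕ
    N = 2 ^ suc m
    N<2N : N < 2 * N
    N<2N = ^-monoʳ-< 2 (s≤s (s≤s z≤n)) {suc m} {suc (suc m)} ≤-refl
    2N∸N≡N : 2 * N ∸ N ≡ N
    2N∸N≡N = trans (cong (_∸ N) (twice N)) (m+n∸n≡m N N)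

  ν-top-1 : ∀ m → ν (suc m) (2 ^ suc m ∸ 1) ≡ m
  ν-top-1 zero = refl
  ν-top-1 (suc m) = begin
    ν (suc (suc m)) (2 * N ∸ 1)         ≡⟨ ν-high (suc m) (2 * N ∸ 1) N<2N-1 ⟩
    νhigh (suc m) (2 * N ∸ 1 ∸ N)       ≡⟨ cong (νhigh (suc m)) 2N-1-N≡N-1 ⟩
    νhigh (suc m) (N ∸ 1)               ≡⟨ νhigh-odd (suc m) (N ∸ 1) (2 ^ m ∸ 1) N-1-odd ⟩
    (suc m + suc m) ∸ v2 (suc (N ∸ 1))  ≡⟨ cong (λ z → (suc m + suc m) ∸ v2 z) (suc-pred N {{m^n≢0 2 (suc m)}}) ⟩
    (suc m + suc m) ∸ v2 N              ≡⟨ cong ((suc m + suc m) ∸_) (v2-pow (suc m)) ⟩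
    (suc m + suc m) ∸ suc m             ≡⟨ m+n∸n≡m (suc m) (suc m) ⟩
    suc m                               ∎
    where
    open ≡-Reasoning
    N : ℕ
    N = 2 ^ suc m
    N<2N-1 : N < 2 * N ∸ 1
    N<2N-1 = m+n≤o⇒m≤o∸n (suc N) (subst (_≤ 2 * N) (+-comm 1 (suc N)) (subst (2 + N ≤_) (sym (twice N)) (+-monoˡ-≤ N (2≤2^[1+n] m))))
    2N-1-N≡N-1 : 2 * N ∸ 1 ∸ N ≡ N ∸ 1
    2N-1-N≡N-1 = trans (∸-+-assoc (2 * N) 1 N) (trans (cong (2 * N ∸_) (+-comm 1 N))
                   (trans (sym (∸-+-assoc (2 * N) N 1)) (cong (_∸ 1) (trans (cong (_∸ N) (twice N)) (m+n∸n≡m N N)))))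
    N-1-odd : N ∸ 1 ≡ suc (2 * (2 ^ m ∸ 1))
    N-1-odd = trans (cong (λ z → 2 * z ∸ 1) (sym (suc-pred (2 ^ m) {{m^n≢0 2 m}}))) (lem (2 ^ m ∸ 1))
      where
      lem : ∀ x → 2 * suc x ∸ 1 ≡ suc (2 * x)
      lem x = cong (_∸ 1) (l x)
        where
        l : ∀ x → 2 * suc x ≡ suc (suc (2 * x))
        l = solve-∀

  ν-one : ∀ n → ν n 1 + n + 1 ≡ 2 ^ n
  ν-one zero = refl
  ν-one (suc n) = begin
      ν (suc n) 1 + suc n + 1 ≡⟨ cong (λ z → z + suc n + 1) (ν-low n 1 (m^n>0 2 n)) ⟩
      (2 ^ n ∸ 1) + ν n 1 + suc n + 1 ≡⟨ l (2 ^ n ∸ 1) (ν n 1) n ⟩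
      ((2 ^ n ∸ 1) + 1) + (ν n 1 + n + 1) ≡⟨ cong₂ _+_ (m∸n+n≡m (m^n>0 2 n)) (ν-one n) ⟩
      2 ^ n + 2 ^ n ≡⟨ sym (twice (2 ^ n)) ⟩
      2 ^ suc n ∎
    where
    open ≡-Reasoning
    l : ∀ a b n → a + b + suc n + 1 ≡ (a + 1) + (b + n + 1)
    l = solve-∀

-- The formula is maximal at k = 1. For k ≤ 2^n this is the inductive hypothesis plus
-- 2^n - k ≤ 2^n - 1; for k > 2^n the value is at most 2n - 1 ≤ (2^n - 1) + ν n 1.
module FormulaMaximum where

  open import Data.Nat
  open import Data.Nat.Properties
  open import Data.Sum using (inj₁; inj₂)
  open import Relation.Binary.PropositionalEquality
  open import Data.Nat.Tactic.RingSolver using (solve-∀)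
  open TwoAdic
  open ValuationFormula

  MaxAtOne : ℕ → Set
  MaxAtOne n = ∀ k → 1 ≤ k → k ≤ 2 ^ n → ν n k ≤ ν n 1

  maxAtOne-base : MaxAtOne 1
  maxAtOne-base (suc zero) _ _ = ≤-refl
  maxAtOne-base (suc (suc zero)) _ _ = z≤n
  maxAtOne-base (suc (suc (suc k))) _ (s≤s (s≤s ()))

  maxAtOne-step : ∀ n → 1 ≤ n → MaxAtOne n → MaxAtOne (suc n)
  maxAtOne-step n pn IH k pk _ with ≤-<-connex k (2 ^ n)
  ... | inj₁ k≤N = subst₂ _≤_ (sym (ν-low n k k≤N)) (sym (ν-low n 1 (m^n>0 2 n)))
                     (+-mono-≤ (∸-monoʳ-≤ (2 ^ n) pk) (IH k pk k≤N))
  ... | inj₂ N<k = subst₂ _≤_ (sym (ν-high n k N<k)) (sym (ν-low n 1 (m^n>0 2 n)))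
                     (≤-trans (νhigh-ub n (k ∸ 2 ^ n) (m<n⇒0<n∸m N<k)) fin)
    where
    N : ℕ
    N = 2 ^ n
    V1 : ℕ
    V1 = ν n 1
    -- (2^n - 1) + ν n 1 = 2^(n+1) - n - 2, so 2n - 1 ≤ (2^n - 1) + ν n 1 amounts to 3n + 1 ≤ 2^(n+1).
    e1 : (N ∸ 1) + V1 + (n + 2) ≡ 2 * N
    e1 = begin
      (N ∸ 1) + V1 + (n + 2) ≡⟨ l (N ∸ 1) V1 n ⟩
      ((N ∸ 1) + 1) + (V1 + n + 1) ≡⟨ cong₂ _+_ (m∸n+n≡m (m^n>0 2 n)) (ν-one n) ⟩
      N + N ≡⟨ sym (twice N) ⟩
      2 * N ∎
      where
      open ≡-Reasoning
      l : ∀ a b n → a + b + (n + 2) ≡ (a + 1) + (b + n + 1)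
      l = solve-∀
    e2 : ((n + n) ∸ 1) + (n + 2) ≡ 3 * n + 1
    e2 = trans (cong (((n + n) ∸ 1) +_) (+-comm n 2)) (trans (sym (+-assoc ((n + n) ∸ 1) 1 (suc n)))
          (trans (cong (_+ suc n) (m∸n+n≡m (≤-trans pn (m≤m+n n n)))) (l n)))
      where
      l : ∀ n → n + n + suc n ≡ 3 * n + 1
      l = solve-∀
    fin : (n + n) ∸ 1 ≤ (N ∸ 1) + V1
    fin = +-cancelʳ-≤ (n + 2) ((n + n) ∸ 1) ((N ∸ 1) + V1)
            (subst₂ _≤_ (sym e2) (sym e1) (3n+1≤2^[1+n] n pn))

  maxAtOne : ∀ n → 1 ≤ n → MaxAtOne n
  maxAtOne (suc zero) _ = maxAtOne-base
  maxAtOne (suc (suc n)) _ = maxAtOne-step (suc n) (s≤s z≤n) (maxAtOne (suc n) (s≤s z≤n))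

-- The dominant term of s(2N, k) = Σ_t A_t · B_{k-t}, with A = ∏_{i<N} (x + 2i + 1) and
-- B = ∏_{i<N} (x + 2i): some t₀ (even, so that A_{t₀} has exact valuation νA n t₀)
-- achieves νA n t₀ + νB n (k - t₀) = ν (n + 1) k, and every other t exceeds it.
-- For k ≤ N the dominant index is t₀ = 0, for k > N it is k - N or k - N + 1.
module DominantTerm where

  open import Data.Nat
  open import Data.Nat.Properties
  open import Data.Product using (∃-syntax; _,_; proj₁; proj₂)
  open import Data.Sum using (inj₁; inj₂)
  open import Data.Empty using (⊥-elim)
  open import Relation.Nullary using (yes; no)
  open import Relation.Binary.PropositionalEquality
  open import Data.Nat.Tactic.RingSolver using (solve-∀)
  open import Defs using (v2)
  open TwoAdic
  open ValuationFormula

  LowerBound₁ : ℕ → Set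
  LowerBound₁ n = ∀ j → 1 ≤ j → j < 2 ^ n → n ≤ νB n j

  LowerBound₂ : ℕ → Set
  LowerBound₂ n = ∀ j h → j ≡ suc (2 * h) → j + 3 ≤ 2 ^ n → n + n ≤ νB n j

  -- Neither bound needs induction: at level n + 1 both follow from the definition of ν.
  lowerBound₁-suc : ∀ n → LowerBound₁ (suc n)
  lowerBound₁-suc n j _ qj with ≤-<-connex j (2 ^ n)
  ... | inj₁ j≤N = subst (λ z → suc n ≤ (2 * 2 ^ n ∸ j) + z) (sym (ν-low n j j≤N))
          (≤-trans (n<2^n n) (≤-trans N≤ (m≤m+n _ _)))
    where
    N≤ : 2 ^ n ≤ 2 * 2 ^ n ∸ j
    N≤ = m+n≤o⇒m≤o∸n (2 ^ n) (subst (2 ^ n + j ≤_) (sym (twice (2 ^ n))) (+-monoʳ-≤ (2 ^ n) j≤N))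
  ... | inj₂ N<j = subst (λ z → suc n ≤ (2 * 2 ^ n ∸ j) + z) (sym (ν-high n j N<j))
                   (subst (λ z → suc n ≤ z + νhigh n r) (sym deq) (go (parity-of r)))
    where
    N : ℕ
    N = 2 ^ n
    r : ℕ
    r = j ∸ N
    jeq : j ≡ N + r
    jeq = sym (m+[n∸m]≡n (<⇒≤ N<j))
    deq : 2 * N ∸ j ≡ N ∸ r
    deq = trans (cong₂ _∸_ (twice N) jeq) ([m+n]∸[m+o]≡n∸o N N r)
    r≥1 : 1 ≤ r
    r≥1 = m<n⇒0<n∸m N<j
    r<N : r < N
    r<N = +-cancelˡ-< N r N (subst (_< N + N) jeq (subst (j <_) (twice N) qj))
    go : Parity r → suc n ≤ (N ∸ r) + νhigh n r
    go (odd h e) = subst (suc n ≤_) (+-comm (νhigh n r) (N ∸ r))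
                    (subst (_≤ νhigh n r + (N ∸ r)) (+-comm n 1) (+-mono-≤ (νhigh-odd-lb n r h e r<N) (m<n⇒0<n∸m r<N)))
    go (even h e) = subst (λ z → suc n ≤ (N ∸ r) + z) (sym (νhigh-even n r h e))
                    (≤-trans (≤-reflexive (cong suc (sym (m+[n∸m]≡n vr))))
                     (+-monoˡ-≤ (n ∸ v2 r) (v2<pow∸ n r r≥1 r<N)))
      where
      vr : v2 r ≤ n
      vr = <⇒≤ (v2<n r n r≥1 r<N)

  lowerBound₂-low : ∀ n' j h → j ≡ suc (2 * h) → j ≤ 2 ^ suc n' →
    suc (suc n') + suc (suc n') ≤ νB (suc (suc n')) j
  lowerBound₂-low n' j h jeqo j≤N = subst (λ z → suc n + suc n ≤ (2 * N ∸ j) + z) (sym (ν-low n j j≤N)) fin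
    where
    n : ℕ
    n = suc n'
    N : ℕ
    N = 2 ^ n
    Neven : N ≡ 2 * 2 ^ n'
    Neven = refl
    j<N : j < N
    j<N = ≤∧≢⇒< j≤N (λ e → even∧odd⇒⊥ (2 ^ n') h (trans e Neven) jeqo)
    a1 : suc N ≤ 2 * N ∸ j
    a1 = m+n≤o⇒m≤o∸n (suc N) (subst (suc N + j ≤_) (sym (twice N)) (subst (_≤ N + N) (+-suc N j) (+-monoʳ-≤ N j<N)))
    a2 : 1 ≤ N ∸ j
    a2 = m<n⇒0<n∸m j<N
    fin : suc n + suc n ≤ (2 * N ∸ j) + ((N ∸ j) + ν n j)
    fin = ≤-trans (subst (_≤ suc N + 1) (sym (cong suc (+-suc n n))) (s≤s (subst (_≤ N + 1) (+-comm (n + n) 1) (+-monoˡ-≤ 1 (2n≤2^n n (s≤s z≤n))))))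
            (≤-trans (+-mono-≤ a1 a2) (+-monoʳ-≤ (2 * N ∸ j) (m≤m+n (N ∸ j) (ν n j))))

  lowerBound₂-high : ∀ n' j h → j ≡ suc (2 * h) → j + 3 ≤ 2 ^ suc (suc n') → 2 ^ suc n' < j →
    suc (suc n') + suc (suc n') ≤ νB (suc (suc n')) j
  lowerBound₂-high n' j h jeqo qj N<j = subst (λ z → suc n + suc n ≤ (2 * N ∸ j) + z) (sym (ν-high n j N<j))
                   (subst (λ z → suc n + suc n ≤ z + νhigh n r) (sym deq) (go (parity-of r)))
    where
    n : ℕ
    n = suc n'
    N : ℕ
    N = 2 ^ n
    r : ℕ
    r = j ∸ N
    jeq : j ≡ N + r
    jeq = sym (m+[n∸m]≡n (<⇒≤ N<j))
    deq : 2 * N ∸ j ≡ N ∸ r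
    deq = trans (cong₂ _∸_ (twice N) jeq) ([m+n]∸[m+o]≡n∸o N N r)
    r3 : r + 3 ≤ N
    r3 = +-cancelˡ-≤ N (r + 3) N (subst (_≤ N + N) (trans (cong (_+ 3) jeq) (+-assoc N r 3)) (subst (j + 3 ≤_) (twice N) qj))
    go : Parity r → suc n + suc n ≤ (N ∸ r) + νhigh n r
    go (even h' e) = ⊥-elim (even∧odd⇒⊥ (2 ^ n' + h') h (trans jeq (trans (cong (N +_) e) (l (2 ^ n') h'))) jeqo)
      where
      l : ∀ a b → 2 * a + 2 * b ≡ 2 * (a + b)
      l = solve-∀
    go (odd h' e) = subst (λ z → suc n + suc n ≤ (N ∸ r) + z) (sym (νhigh-odd n r h' e)) fin
      where
      sr<N : suc r < N
      sr<N = ≤-trans (n≤1+n (suc (suc r))) (subst (_≤ N) (+-comm r 3) r3)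
      v : ℕ
      v = v2 (suc r)
      vle : v ≤ n + n
      vle = ≤-trans (<⇒≤ (v2<n (suc r) n (s≤s z≤n) sr<N)) (m≤m+n n n)
      Nr : N ∸ r ≡ suc (N ∸ suc r)
      Nr = +-∸-assoc 1 (<⇒≤ sr<N)
      b : suc (suc v) ≤ N ∸ r
      b = subst (suc (suc v) ≤_) (sym Nr) (s≤s (v2<pow∸ n (suc r) (s≤s z≤n) sr<N))
      fin : suc n + suc n ≤ (N ∸ r) + ((n + n) ∸ v)
      fin = ≤-trans (≤-reflexive (trans (cong suc (+-suc n n)) (cong (λ z → suc (suc z)) (sym (m+[n∸m]≡n vle)))))
             (+-monoˡ-≤ ((n + n) ∸ v) b)

  lowerBound₂-suc : ∀ n' → LowerBound₂ (suc (suc n'))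
  lowerBound₂-suc n' j h jeqo qj with ≤-<-connex j (2 ^ suc n')
  ... | inj₁ j≤N = lowerBound₂-low n' j h jeqo j≤N
  ... | inj₂ N<j = lowerBound₂-high n' j h jeqo qj N<j

  lowerBound₁ : ∀ n → 1 ≤ n → LowerBound₁ n
  lowerBound₁ (suc zero) _ (suc zero) _ _ = s≤s z≤n
  lowerBound₁ (suc zero) _ (suc (suc j)) _ (s≤s (s≤s ()))
  lowerBound₁ (suc (suc n)) _ = lowerBound₁-suc (suc n)

  lowerBound₂ : ∀ n → 1 ≤ n → LowerBound₂ n
  lowerBound₂ (suc zero) _ j h e q = ⊥-elim (<⇒≱ (s≤s (s≤s (s≤s z≤n))) (≤-trans (m≤n+m 3 j) q))
  lowerBound₂ (suc (suc n)) _ = lowerBound₂-suc n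

  StepBound : ℕ → Set
  StepBound n = ∀ k t → 1 ≤ t → t < k → k ≤ 2 ^ n → ν n k < ν n (k ∸ t) + t + νA n t

  stepBound-base : StepBound 1
  stepBound-base (suc (suc zero)) (suc zero) _ _ _ = s≤s z≤n
  stepBound-base (suc (suc zero)) (suc (suc t)) _ (s≤s (s≤s ())) _
  stepBound-base (suc (suc (suc k))) t _ _ (s≤s (s≤s ()))
  stepBound-base (suc zero) (suc zero) _ (s≤s ()) _

  -- Adding A = 2^n - k to both sides of the inductive hypothesis.
  shifted-step : ∀ A V V' t L L' → V < V' + t + L → L ≤ L' → A + V < (A + t + V') + t + L'
  shifted-step A V V' t L L' h l = ≤-trans (subst (_≤ A + (V' + t + L)) (+-suc A V) (+-monoʳ-≤ A h))
     (≤-trans (+-monoʳ-≤ A (+-monoʳ-≤ (V' + t) l)) (≤-trans (m≤m+n (A + (V' + t + L')) t) (≤-reflexive (e A V' t L'))))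
    where
    e : ∀ A V' t L' → A + (V' + t + L') + t ≡ A + t + V' + t + L'
    e = solve-∀

  tail≤ : ∀ X t L → t + L ≤ X + t + L
  tail≤ X t L = +-monoˡ-≤ L (m≤n+m t X)

  νhigh< : ∀ n s → 1 ≤ n → s ≤ (n + n) ∸ 1 → s < n + suc (suc n)
  νhigh< (suc n) s _ p = ≤-trans (s≤s p) (s≤s (+-monoʳ-≤ n (s≤s (≤-trans (n≤1+n n) (n≤1+n (suc n))))))

  -- The step bound at level n + 1 for k > 2^n, where ν (n + 1) k = νhigh n (k - 2^n) ≤ 2n - 1.
  module StepHigh (n : ℕ) (pn : 1 ≤ n) (lb1 : LowerBound₁ n) (k t : ℕ) (pt : 1 ≤ t) (tk : t < k)
                  (kN : k ≤ 2 ^ suc n) (N<k : 2 ^ n < k) where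
    N : ℕ
    N = 2 ^ n
    r : ℕ
    r = k ∸ N
    keq : k ≡ N + r
    keq = sym (m+[n∸m]≡n (<⇒≤ N<k))
    r≥1 : 1 ≤ r
    r≥1 = m<n⇒0<n∸m N<k
    r≤N : r ≤ N
    r≤N = +-cancelˡ-≤ N r N (subst (_≤ N + N) keq (subst (k ≤_) (twice N) kN))
    small : νhigh n r ≤ (n + n) ∸ 1
    small = νhigh-ub n r r≥1
    X : ℕ
    X = ν (suc n) (k ∸ t)
    L : ℕ
    L = νA (suc n) t

    -- When k - t ≤ 2^n: either t = r, compared directly, or νB-type bound ν n (k - t) ≥ n.
    below : k ∸ t ≤ N → νhigh n r < X + t + L
    below kt≤N with t ≟ r
    ... | yes t≡r = ≤-trans (tr (parity-of r)) (tail≤ X t L)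
      where
      tr : Parity r → νhigh n r < t + L
      tr (odd h e) = subst (λ z → νhigh n r < t + z) (sym (νA-odd (suc n) t h (trans t≡r e)))
                      (≤-trans (νhigh< n (νhigh n r) pn small) (≤-trans (≤-reflexive (+-suc n (suc n))) (m≤n+m _ t)))
      tr (even h e) = subst (λ z → νhigh n r < t + z) (sym (νA-even (suc n) t h pt (trans t≡r e)))
                      (subst (_< t + (suc n ∸ v2 t)) (sym (trans (νhigh-even n r h e) (cong (λ z → n ∸ v2 z) (sym t≡r))))
                        (+-mono-≤ pt (∸-monoˡ-≤ (v2 t) (n≤1+n n))))
    ... | no t≢r = ≤-trans (νhigh< n (νhigh n r) pn small)
                     (≤-trans (+-mono-≤ w (n<t+νA (suc n) t pt)) (≤-reflexive (sym (+-assoc X t L))))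
      where
      kt≢N : k ∸ t ≢ N
      kt≢N e = t≢r (trans (sym (m∸[m∸n]≡n (<⇒≤ tk))) (cong (k ∸_) e))
      w : n ≤ X
      w = subst (n ≤_) (sym (ν-low n (k ∸ t) kt≤N)) (lb1 (k ∸ t) (m<n⇒0<n∸m tk) (≤∧≢⇒< kt≤N kt≢N))

    above : N < k ∸ t → νhigh n r < X + t + L
    above N<kt = by-t (parity-of t)
      where
      r' : ℕ
      r' = (k ∸ t) ∸ N
      Xeq : X ≡ νhigh n r'
      Xeq = ν-high n (k ∸ t) N<kt
      req : r ≡ r' + t
      req = sym (begin
          (k ∸ t) ∸ N + t ≡⟨ sym (+-∸-comm t (<⇒≤ N<kt)) ⟩
          (k ∸ t) + t ∸ N ≡⟨ cong (_∸ N) (m∸n+n≡m (<⇒≤ tk)) ⟩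
          k ∸ N ∎)
        where open ≡-Reasoning
      by-t : Parity t → νhigh n r < X + t + L
      by-t (odd h e) = ≤-trans (νhigh< n (νhigh n r) pn small) (subst (_≤ X + t + L) eqL (m≤n+m L (X + t)))
        where
        eqL : L ≡ n + suc (suc n)
        eqL = trans (νA-odd (suc n) t h e) (sym (+-suc n (suc n)))
      by-t (even h e) = by-r (parity-of r)
        where
        by-r : Parity r → νhigh n r < X + t + L
        by-r (even h' e') = ≤-trans (s≤s (≤-trans (νhigh-even-ub n r h' r≥1 e') (≤-trans (m∸n≤m n 1) (n≤1+n n))))
                                    (≤-trans (n<t+νA (suc n) t pt) (tail≤ X t L))
        by-r (odd h' e') = by-r' (parity-of r')
          where
          by-r' : Parity r' → νhigh n r < X + t + L
          by-r' (even h'' e'') = ⊥-elim (even∧odd⇒⊥ (h'' + h) h' (trans req (trans (cong₂ _+_ e'' e) (l h'' h))) e')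
            where
            l : ∀ a b → 2 * a + 2 * b ≡ 2 * (a + b)
            l = solve-∀
          by-r' (odd h'' e'') = ≤-trans (νhigh< n (νhigh n r) pn small)
                                  (≤-trans (+-mono-≤ w (n<t+νA (suc n) t pt)) (≤-reflexive (sym (+-assoc X t L))))
            where
            r'<r : r' < r
            r'<r = subst (r' <_) (sym req) (subst (_≤ r' + t) (+-comm r' 1) (+-monoʳ-≤ r' pt))
            w : n ≤ X
            w = subst (n ≤_) (sym Xeq) (νhigh-odd-lb n r' h'' e'' (≤-trans r'<r r≤N))

    bound : ν (suc n) k < X + t + L
    bound with ≤-<-connex (k ∸ t) N
    ... | inj₁ kt≤N = subst (_< X + t + L) (sym (ν-high n k N<k)) (below kt≤N)
    ... | inj₂ N<kt = subst (_< X + t + L) (sym (ν-high n k N<k)) (above N<kt)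

  stepBound-step : ∀ n → 1 ≤ n → StepBound n → LowerBound₁ n → StepBound (suc n)
  stepBound-step n pn IH lb1 k t pt tk kN with ≤-<-connex k (2 ^ n)
  ... | inj₁ k≤N = subst₂ (λ a b → a < b + t + νA (suc n) t) (sym (ν-low n k k≤N)) (sym (ν-low n (k ∸ t) (≤-trans (m∸n≤m k t) k≤N)))
        (subst (λ z → (2 ^ n ∸ k) + ν n k < (z + ν n (k ∸ t)) + t + νA (suc n) t) (sym (∸-∸-swap (2 ^ n) k t (<⇒≤ tk) k≤N))
          (shifted-step (2 ^ n ∸ k) (ν n k) (ν n (k ∸ t)) t (νA n t) (νA (suc n) t) (IH k t pt tk k≤N) (νA-mono n t)))
  ... | inj₂ N<k = StepHigh.bound n pn lb1 k t pt tk kN N<k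

  stepBound : ∀ n → 1 ≤ n → StepBound n
  stepBound (suc zero) _ = stepBound-base
  stepBound (suc (suc n)) _ = stepBound-step (suc n) (s≤s z≤n) (stepBound (suc n) (s≤s z≤n)) (lowerBound₁ (suc n) (s≤s z≤n))

  record Dominant (n k : ℕ) : Set where
    field
      t₀ : ℕ
      t₀≤k : t₀ ≤ k
      t₀≤N : t₀ ≤ 2 ^ n
      rest≥1 : 1 ≤ k ∸ t₀
      rest≤N : k ∸ t₀ ≤ 2 ^ n
      t₀-even : ∃[ h ] t₀ ≡ 2 * h
      value : νA n t₀ + νB n (k ∸ t₀) ≡ ν (suc n) k
      others : ∀ t → t ≤ k → t ≢ t₀ → t ≤ 2 ^ n → 1 ≤ k ∸ t → k ∸ t ≤ 2 ^ n →
               suc (ν (suc n) k) ≤ νA n t + νB n (k ∸ t)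

  -- For k ≤ 2^n the dominant index is t₀ = 0: this is the step bound.
  dominant-low : ∀ n k → 1 ≤ n → 1 ≤ k → k ≤ 2 ^ n → Dominant n k
  dominant-low n k n≥1 pk k≤N = record
    { t₀ = 0 ; t₀≤k = z≤n ; t₀≤N = z≤n ; rest≥1 = pk ; rest≤N = k≤N ; t₀-even = 0 , refl
    ; value = sym (ν-low n k k≤N)
    ; others = λ t t≤k t≢0 _ rest≥1 _ → others t t≤k t≢0 rest≥1 }
    where
    N : ℕ
    N = 2 ^ n
    others : ∀ t → t ≤ k → t ≢ 0 → 1 ≤ k ∸ t → suc (ν (suc n) k) ≤ νA n t + νB n (k ∸ t)
    others t t≤k t≢0 rest≥1 = subst₂ (λ a b → suc a ≤ νA n t + b) (sym (ν-low n k k≤N))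
        (cong (_+ ν n (k ∸ t)) (sym (∸-∸-swap N k t t≤k k≤N)))
        (≤-trans (subst (_≤ (N ∸ k) + (ν n (k ∸ t) + t + νA n t)) (+-suc (N ∸ k) (ν n k)) (+-monoʳ-≤ (N ∸ k) step))
          (≤-reflexive (lem (N ∸ k) (ν n (k ∸ t)) t (νA n t))))
      where
      step : ν n k < ν n (k ∸ t) + t + νA n t
      step = stepBound n n≥1 k t (n≢0⇒n>0 t≢0) (m∸n≢0⇒n<m (>⇒≢ rest≥1)) k≤N
      lem : ∀ A V t L → A + (V + t + L) ≡ L + (A + t + V)
      lem = solve-∀

  -- For 2^(m+1) < k ≤ 2^(m+2), with r = k - 2^(m+1): the dominant index is r for even r,
  -- and r + 1 for odd r.
  module HighRange (m k : ℕ) (qk : k ≤ 2 ^ suc (suc m)) (N<k : 2 ^ suc m < k) where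
    n : ℕ
    n = suc m
    N : ℕ
    N = 2 ^ n
    r : ℕ
    r = k ∸ N
    keq : k ≡ N + r
    keq = sym (m+[n∸m]≡n (<⇒≤ N<k))
    r≥1 : 1 ≤ r
    r≥1 = m<n⇒0<n∸m N<k
    r≤N : r ≤ N
    r≤N = +-cancelˡ-≤ N r N (subst (_≤ N + N) keq (subst (k ≤_) (twice N) qk))
    νk : ν (suc n) k ≡ νhigh n r
    νk = ν-high n k N<k
    k∸r : k ∸ r ≡ N
    k∸r = m∸[m∸n]≡n (<⇒≤ N<k)
    -- Only t ≥ r give nonvanishing coefficients B_{k-t}, and t = r is the index with k - t = N.
    r≤t : ∀ t → t ≤ k → k ∸ t ≤ N → r ≤ t
    r≤t t t≤k q = m≤n+o⇒m∸n≤o k N (subst (_≤ N + t) (m∸n+n≡m t≤k) (+-monoˡ-≤ t q))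
    k∸t≡N⇒t≡r : ∀ t → t ≤ k → k ∸ t ≡ N → t ≡ r
    k∸t≡N⇒t≡r t t≤k e = trans (sym (m∸[m∸n]≡n t≤k)) (cong (k ∸_) e)

    dominant-even : ∀ h → r ≡ 2 * h → Dominant n k
    dominant-even h e = record
      { t₀ = r ; t₀≤k = m∸n≤m k N ; t₀≤N = r≤N ; rest≥1 = subst (1 ≤_) (sym k∸r) (m^n>0 2 n)
      ; rest≤N = ≤-reflexive k∸r ; t₀-even = h , e
      ; value = begin
          νA n r + ((N ∸ (k ∸ r)) + ν n (k ∸ r)) ≡⟨ cong (λ z → νA n r + ((N ∸ z) + ν n z)) k∸r ⟩
          νA n r + ((N ∸ N) + ν n N)             ≡⟨ cong₂ (λ a b → a + (b + ν n N)) (νA-even n r h r≥1 e) (n∸n≡0 N) ⟩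
          (n ∸ v2 r) + ν n N                     ≡⟨ cong ((n ∸ v2 r) +_) (ν-top m) ⟩
          (n ∸ v2 r) + 0                         ≡⟨ +-identityʳ _ ⟩
          n ∸ v2 r                               ≡⟨ sym (trans νk (νhigh-even n r h e)) ⟩
          ν (suc n) k                            ∎
      ; others = others }
      where
      open ≡-Reasoning
      others : ∀ t → t ≤ k → t ≢ r → t ≤ N → 1 ≤ k ∸ t → k ∸ t ≤ N → suc (ν (suc n) k) ≤ νA n t + νB n (k ∸ t)
      others t t≤k t≢r _ jp jq = subst (λ a → suc a ≤ νA n t + νB n (k ∸ t)) (sym νk)
          (≤-trans (s≤s (νhigh-even-ub n r h r≥1 e))
                   (≤-trans (lowerBound₁ n (s≤s z≤n) (k ∸ t) jp (≤∧≢⇒< jq (λ q → t≢r (k∸t≡N⇒t≡r t t≤k q)))) (m≤n+m _ (νA n t))))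

    -- For odd r the dominant index is r + 1; all competitors have valuation at least 2n.
    module OddCase (h : ℕ) (e : r ≡ suc (2 * h)) where
      l2 : ∀ h → suc (suc (2 * h)) ≡ 2 * suc h
      l2 = solve-∀
      r<N : r < N
      r<N = ≤∧≢⇒< r≤N (λ q → even∧odd⇒⊥ (2 ^ m) h q e)
      sr≤k : suc r ≤ k
      sr≤k = subst (suc r ≤_) (sym keq) (+-monoˡ-≤ r (m^n>0 2 n))
      ksr : k ∸ suc r ≡ N ∸ 1
      ksr = trans (cong (k ∸_) (+-comm 1 r)) (trans (sym (∸-+-assoc k r 1)) (cong (_∸ 1) k∸r))
      N-1≥1 : 1 ≤ N ∸ 1
      N-1≥1 = m<n⇒0<n∸m (2≤2^[1+n] m)
      v = v2 (suc r)
      vle : v ≤ n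
      vle = v2≤n (suc r) n (s≤s z≤n) r<N
      v≥1 : 1 ≤ v
      v≥1 = subst (λ z → 1 ≤ v2 (suc z)) (sym e) (v2[2h+2]≥1 h)
      νB-N-1 : νB n (N ∸ 1) ≡ n
      νB-N-1 = cong₂ _+_ (m∸[m∸n]≡n (m^n>0 2 n)) (ν-top-1 m)
      value : νA n (suc r) + νB n (k ∸ suc r) ≡ ν (suc n) k
      value = trans (cong₂ _+_ (νA-even n (suc r) (suc h) (s≤s z≤n) (trans (cong suc e) (l2 h))) (trans (cong (νB n) ksr) νB-N-1))
                    (trans (sym (+-∸-comm n vle)) (sym (trans νk (νhigh-odd n r h e))))
      -- Every competitor has valuation at least 2n, which exceeds ν (n + 1) k = 2n - v₂(r + 1).
      below-2n : suc (ν (suc n) k) ≤ n + n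
      below-2n = subst (λ a → suc a ≤ n + n) (sym (trans νk (νhigh-odd n r h e))) (∸-monoʳ-< v≥1 (≤-trans vle (m≤m+n n n)))
      -- An even t ∉ {r, r + 1} leaves an odd j = k - t ≤ 2^n - 3, so νB n j ≥ 2n.
      even-competitor : ∀ t h' → t ≡ 2 * h' → t ≤ k → t ≢ r → t ≢ suc r → k ∸ t ≤ N → n + n ≤ νB n (k ∸ t)
      even-competitor t h' e' t≤k t≢r t≢sr jq = lowerBound₂ n (s≤s z≤n) j h₃ j-odd j+3≤N
        where
        j : ℕ
        j = k ∸ t
        jt : j + t ≡ k
        jt = m∸n+n≡m t≤k
        odd-half : Parity j → ∃[ h₃ ] j ≡ suc (2 * h₃)
        odd-half (odd h₃ q) = h₃ , q
        odd-half (even h₃ q) = ⊥-elim (even∧odd⇒⊥ (h₃ + h') (2 ^ m + h) (trans (sym jt) (trans (cong₂ _+_ q e') (l h₃ h')))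
                                   (trans keq (trans (cong (N +_) e) (l' (2 ^ m) h))))
          where
          l : ∀ a b → 2 * a + 2 * b ≡ 2 * (a + b)
          l = solve-∀
          l' : ∀ a b → 2 * a + suc (2 * b) ≡ suc (2 * (a + b))
          l' = solve-∀
        h₃ : ℕ
        h₃ = proj₁ (odd-half (parity-of j))
        j-odd : j ≡ suc (2 * h₃)
        j-odd = proj₂ (odd-half (parity-of j))
        t≥r+2 : suc (suc r) ≤ t
        t≥r+2 = ≤∧≢⇒< (≤∧≢⇒< (r≤t t t≤k jq) (λ q → t≢r (sym q))) (λ q → t≢sr (sym q))
        j+2≤N : j + 2 ≤ N
        j+2≤N = +-cancelʳ-≤ r (j + 2) N (subst (j + 2 + r ≤_) (trans jt keq) (subst (_≤ j + t) (l j r) (+-monoʳ-≤ j t≥r+2)))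
          where
          l : ∀ j r → j + suc (suc r) ≡ j + 2 + r
          l = solve-∀
        j+3≤N : j + 3 ≤ N
        j+3≤N = subst (_≤ N) (l j) (≤∧≢⇒< j+2≤N (λ q → even∧odd⇒⊥ (2 ^ m) (suc h₃) q (trans (cong (_+ 2) j-odd) (l2' h₃))))
          where
          l : ∀ j → suc (j + 2) ≡ j + 3
          l = solve-∀
          l2' : ∀ h → suc (2 * h) + 2 ≡ suc (2 * suc h)
          l2' = solve-∀

      -- Odd t (including t = r) has νA n t = 2n.
      others : ∀ t → t ≤ k → t ≢ suc r → t ≤ N → 1 ≤ k ∸ t → k ∸ t ≤ N → suc (ν (suc n) k) ≤ νA n t + νB n (k ∸ t)
      others t t≤k t≢sr _ _ jq with t ≟ r | parity-of t
      ... | yes refl | _ = subst (λ z → suc (ν (suc n) k) ≤ z + νB n (k ∸ r)) (sym (νA-odd n r h e)) (≤-trans below-2n (m≤m+n (n + n) _))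
      ... | no _ | odd h' e' = subst (λ z → suc (ν (suc n) k) ≤ z + νB n (k ∸ t)) (sym (νA-odd n t h' e'))
                                     (≤-trans below-2n (m≤m+n (n + n) _))
      ... | no t≢r | even h' e' = ≤-trans below-2n (≤-trans (even-competitor t h' e' t≤k t≢r t≢sr jq) (m≤n+m _ (νA n t)))

      dominant : Dominant n k
      dominant = record
        { t₀ = suc r ; t₀≤k = sr≤k ; t₀≤N = r<N ; rest≥1 = subst (1 ≤_) (sym ksr) N-1≥1
        ; rest≤N = subst (_≤ N) (sym ksr) (m∸n≤m N 1) ; t₀-even = suc h , trans (cong suc e) (l2 h)
        ; value = value
        ; others = others }

    dominant-odd : ∀ h → r ≡ suc (2 * h) → Dominant n k
    dominant-odd h e = OddCase.dominant h e

  dominant-term : ∀ m k → 1 ≤ k → k ≤ 2 ^ suc (suc m) → Dominant (suc m) k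
  dominant-term m k pk qk with ≤-<-connex k (2 ^ suc m)
  ... | inj₁ k≤N = dominant-low (suc m) k (s≤s z≤n) pk k≤N
  ... | inj₂ N<k with parity-of (k ∸ 2 ^ suc m)
  ...   | even h e = HighRange.dominant-even m k qk N<k h e
  ...   | odd h e = HighRange.dominant-odd m k qk N<k h e

module ExactValuation where

  open import Data.Nat
  open import Data.Nat.Properties
  open import Data.Product using (proj₁; proj₂)
  open import Data.Sum using (inj₁; inj₂)
  open import Data.Empty using (⊥-elim)
  open import Relation.Binary.PropositionalEquality
  open import Relation.Binary.Definitions using (tri<; tri≈; tri>)
  open import Data.Nat.Tactic.RingSolver using (solve-∀)
  open import Defs
  open TwoAdic
  open Poly
  open Pairing
  open Squaring using (module Pattern)
  open OddPairs
  open ValuationFormula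
  open DominantTerm

  stirling-prodLin : ∀ N → stirling1 N ≐ prodLin (λ i → i) N
  stirling-prodLin zero zero = refl
  stirling-prodLin zero (suc k) = refl
  stirling-prodLin (suc n) zero = sym (trans (cong (λ z → n * z + 0) (sym (stirling-prodLin n 0))) (trans (+-identityʳ _) (n*s[n,0]≡0 n)))
    where
    n*s[n,0]≡0 : ∀ n → n * stirling1 n 0 ≡ 0
    n*s[n,0]≡0 zero = refl
    n*s[n,0]≡0 (suc n) = *-zeroʳ (suc n)
  stirling-prodLin (suc n) (suc k) = cong₂ (λ a b → n * a + b) (stirling-prodLin n (suc k)) (stirling-prodLin n k)

  oddf : ℕ → ℕ
  oddf i = suc (dbl i)

  module Level (m : ℕ) where
    M : ℕ
    M = 2 ^ m
    N : ℕ
    N = 2 ^ suc m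
    n : ℕ
    n = suc m

    A : Poly
    A = prodLin oddf N

    B : Poly
    B = prodLin dbl N

    -- The factor x + 2i + 1 is paired with x + 2N - 2i - 1; their constants sum to β = 2^(m+2).
    partner : ℕ → ℕ
    partner i = oddf (M + (M ∸ suc i))

    β : ℕ
    β = 2 * (2 * M)

    A-pairs : A ≐ prodPair oddf partner M
    A-pairs = ≐-trans (λ k → cong (λ z → prodLin oddf z k) (twice M))
          (≐-trans (prodLin-split oddf M M)
           (≐-trans (conv-ext {prodLin oddf M} {prodLin oddf M} (λ _ → refl) (prodLin-rev (λ i → oddf (M + i)) M))
            (prodLin-merge oddf partner M)))

    partner-sum : ∀ i → i < M → oddf i + partner i ≡ β
    partner-sum i p = trans (cong₂ (λ a b → suc a + suc b) (dbl≡ i) (dbl≡ (M + (M ∸ suc i))))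
                            (lem M i (M ∸ suc i) (sym (m+[n∸m]≡n p)))
      where
      lem : ∀ M i d → M ≡ suc (i + d) → suc (2 * i) + suc (2 * (M + (M ∸ suc i))) ≡ 2 * (2 * M)
      lem M i d refl = trans (cong (λ z → suc (2 * i) + suc (2 * (suc (i + d) + z))) (m+n∸m≡n i d)) (l i d)
        where
        l : ∀ i d → suc (2 * i) + suc (2 * (suc (i + d) + d)) ≡ 2 * (2 * suc (i + d))
        l = solve-∀

    pair-products : prodLin (λ i → oddf i * partner i) M ≐ G m
    pair-products = prodLin-ext M (λ i _ → cong₂ (λ a b → suc a * suc b) (dbl≡ i) (dbl≡ (M + (M ∸ suc i))))

    R : Poly
    R = proj₁ (pairing β oddf partner M partner-sum)

    open PairForm (proj₂ (pairing β oddf partner M partner-sum))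
    open Pattern (G-pattern m)

    β²-divides : ∀ x → 2^ suc n + suc n ∣ β * β * x
    β²-divides x = pow∣-*ʳ x (subst (2^ suc n + suc n ∣_) (^-distribˡ-+-* 2 (suc n) (suc n)) (pow∣pow ≤-refl))

    -- Even coefficients of A are those of G_m up to a multiple of β².
    A-even : ∀ j e → 2^ e ‖ G m j → suc e ≤ suc n + suc n → 2^ e ‖ A (dbl j)
    A-even j e v le = subst (2^ e ‖_) (sym (trans (A-pairs (dbl j)) (even-coeff j)))
                   (‖-+-higher (subst (2^ e ‖_) (sym (pair-products j)) v) (pow∣-weaken le (β²-divides (R (dbl j)))))

    -- Odd coefficients of A are β (j + 1) G_{j+1} up to β², hence divisible by 2^(2n).
    A-odd : ∀ j → 2^ n + n ∣ A (suc (dbl j))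
    A-odd j = subst (2^ n + n ∣_) (sym (trans (A-pairs (suc (dbl j))) (odd-coeff j)))
            (pow∣-+ (subst (λ z → 2^ z ∣ β * (suc j * prodLin (λ i → oddf i * partner i) M (suc j))) exponent
                      (pow∣-* {suc n} {m} (pow∣pow ≤-refl) (subst (2^ m ∣_) (cong (suc j *_) (sym (pair-products (suc j)))) derivative)))
                    (pow∣-weaken (+-mono-≤ (n≤1+n n) (n≤1+n n)) (β²-divides (R (suc (dbl j))))))
      where
      exponent : suc n + m ≡ n + n
      exponent = sym (cong suc (+-suc m m))
      -- v₂((j + 1) G_{j+1}) ≥ m, from v₂(G_{j+1}) = m - v₂(j + 1).
      derivative : 2^ m ∣ suc j * G m (suc j)
      derivative with <-cmp (suc j) M
      ... | tri< p _ _ = ‖⇒∣ (subst (λ z → 2^ z ‖ suc j * G m (suc j)) (m+[n∸m]≡n (<⇒≤ (v2<n (suc j) m (s≤s z≤n) p)))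
                           (‖-* (v2-correct (suc j) (s≤s z≤n)) (inner (suc j) (s≤s z≤n) p)))
      ... | tri≈ _ p _ = subst (2^ m ∣_) (sym (trans (cong (λ z → z * G m z) p) (trans (cong (M *_) (G-monic m)) (*-identityʳ M)))) (pow∣pow ≤-refl)
      ... | tri> _ _ p = subst (2^ m ∣_) (sym (trans (cong (suc j *_) (G-vanish m (suc j) p)) (*-zeroʳ (suc j)))) (pow∣0 m)

    A-vanish : ∀ t → N < t → A t ≡ 0
    A-vanish t p = prodLin-deg oddf N t p

    A-even-exact : ∀ t h → t ≤ N → t ≡ 2 * h → 2^ νA n t ‖ A t
    A-even-exact t zero _ e = subst (λ z → 2^ νA n z ‖ A z) (sym e) (A-even 0 0 constant-odd (s≤s z≤n))
    A-even-exact t (suc h) tN e with <-cmp (suc h) M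
    ... | tri< p _ _ = subst (λ z → 2^ νA n z ‖ A z) (sym e')
          (subst (λ z → 2^ z ‖ A (dbl (suc h))) (sym νA≡)
            (A-even (suc h) (m ∸ v2 (suc h)) (inner (suc h) (s≤s z≤n) p) (s≤s (≤-trans (m∸n≤m m (v2 (suc h))) (≤-trans (n≤1+n m) (m≤m+n _ _))))))
      where
      e' : t ≡ dbl (suc h)
      e' = trans e (sym (dbl≡ (suc h)))
      νA≡ : νA n (dbl (suc h)) ≡ m ∸ v2 (suc h)
      νA≡ = trans (νA-even n (dbl (suc h)) (suc h) (s≤s z≤n) (dbl≡ (suc h)))
                  (cong (n ∸_) (trans (cong v2 (dbl≡ (suc h))) (v2-double (suc h) (s≤s z≤n))))
    ... | tri≈ _ p _ = subst (λ z → 2^ νA n z ‖ A z) (sym e')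
          (subst (λ z → 2^ z ‖ A (dbl M)) (sym νA≡) (A-even M 0 (subst (2^ 0 ‖_) (sym (G-monic m)) ‖-one) (s≤s z≤n)))
      where
      e' : t ≡ dbl M
      e' = trans e (trans (cong (2 *_) p) (sym (dbl≡ M)))
      νA≡ : νA n (dbl M) ≡ 0
      νA≡ = trans (νA-even n (dbl M) M (subst (1 ≤_) (sym (dbl≡ M)) (≤-trans (m^n>0 2 m) (m≤m+n M _))) (dbl≡ M))
                  (trans (cong (n ∸_) (trans (cong v2 (dbl≡ M)) (v2-pow n))) (n∸n≡0 n))
    ... | tri> _ _ p = ⊥-elim (<⇒≱ (subst (N <_) (sym e) (*-monoʳ-< 2 p)) tN)

    A-divisible : ∀ t → 2^ νA n t ∣ A t
    A-divisible t with ≤-<-connex t N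
    ... | inj₂ p = subst (2^ νA n t ∣_) (sym (A-vanish t p)) (pow∣0 _)
    ... | inj₁ tN with parity-of t
    ...   | even h e = ‖⇒∣ (A-even-exact t h tN e)
    ...   | odd h e = subst (λ z → 2^ z ∣ A t) (sym (νA-odd n t h e))
                      (subst (λ z → 2^ n + n ∣ A z) (sym (trans e (cong suc (sym (dbl≡ h))))) (A-odd h))

    B-scaled : ∀ j → 2 ^ j * B j ≡ 2 ^ N * stirling1 N j
    B-scaled j = trans (cong (2 ^ j *_) (prodLin-ext N (λ i _ → dbl≡ i) j))
                       (trans (prodLin-double (λ i → i) N j) (cong (2 ^ N *_) (sym (stirling-prodLin N j))))

    B-exact : ∀ j → j ≤ N → 2^ ν n j ‖ stirling1 N j → 2^ νB n j ‖ B j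
    B-exact j jN v = subst (2^ νB n j ‖_) (sym B≡) (‖-pow* (N ∸ j) v)
      where
      B≡ : B j ≡ 2 ^ (N ∸ j) * stirling1 N j
      B≡ = *-cancelˡ-≡ (B j) _ (2 ^ j) {{m^n≢0 2 j}} (begin
        2 ^ j * B j                            ≡⟨ B-scaled j ⟩
        2 ^ N * stirling1 N j                  ≡⟨ cong (λ z → 2 ^ z * stirling1 N j) (sym (m+[n∸m]≡n jN)) ⟩
        2 ^ (j + (N ∸ j)) * stirling1 N j      ≡⟨ cong (_* stirling1 N j) (^-distribˡ-+-* 2 j (N ∸ j)) ⟩
        2 ^ j * 2 ^ (N ∸ j) * stirling1 N j    ≡⟨ *-assoc (2 ^ j) (2 ^ (N ∸ j)) (stirling1 N j) ⟩
        2 ^ j * (2 ^ (N ∸ j) * stirling1 N j)  ∎)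
        where open ≡-Reasoning

    B-zero : B 0 ≡ 0
    B-zero = trans (sym (*-identityˡ (B 0)))
                   (trans (B-scaled 0) (trans (cong (2 ^ N *_) (s[x,0]≡0 (m^n>0 2 n))) (*-zeroʳ (2 ^ N))))
      where
      s[x,0]≡0 : ∀ {x} → 1 ≤ x → stirling1 x 0 ≡ 0
      s[x,0]≡0 {suc x} _ = refl

    B-vanish : ∀ j → N < j → B j ≡ 0
    B-vanish j p = prodLin-deg dbl N j p

    stirling-split : ∀ k → stirling1 (2 ^ suc n) k ≡ conv A B k
    stirling-split k = trans (stirling-prodLin (2 ^ suc n) k) (trans (cong (λ z → prodLin (λ i → i) z k) (sym (dbl≡ N)))
                 (trans (prodLin-dbl (λ i → i) N k) (sym (prodLin-merge oddf dbl N k))))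

  ExactFormula : ℕ → Set
  ExactFormula n = ∀ k → 1 ≤ k → k ≤ 2 ^ n → 2^ ν n k ‖ stirling1 (2 ^ n) k

  -- The inductive step: in s(2N, k) = Σ_t A_t B_{k-t} the dominant index has valuation
  -- ν (n + 1) k and all other terms are divisible by a higher power of two.
  exact-step : ∀ m → ExactFormula (suc m) → ExactFormula (suc (suc m))
  exact-step m IH k pk qk = subst (2^ ν (suc n) k ‖_) (sym (stirling-split k))
      (sum-‖-dominant _ (suc k) t₀ (s≤s t₀≤k) dominant others-divisible)
    where
    open Level m
    open Dominant (dominant-term m k pk qk)
    dominant : 2^ ν (suc n) k ‖ A t₀ * B (k ∸ t₀)
    dominant = subst (λ z → 2^ z ‖ A t₀ * B (k ∸ t₀)) value
      (‖-* (A-even-exact t₀ (proj₁ t₀-even) t₀≤N (proj₂ t₀-even)) (B-exact (k ∸ t₀) rest≤N (IH (k ∸ t₀) rest≥1 rest≤N)))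
    higher : ℕ
    higher = suc (ν (suc n) k)
    others-divisible : ∀ t → t < suc k → t ≢ t₀ → 2^ higher ∣ A t * B (k ∸ t)
    others-divisible t tk ne with ≤-<-connex t N
    ... | inj₂ p = subst (2^ higher ∣_) (sym (cong (_* B (k ∸ t)) (A-vanish t p))) (pow∣0 _)
    ... | inj₁ tN with ≤-<-connex (k ∸ t) N
    ...   | inj₂ p = subst (2^ higher ∣_) (sym (trans (cong (A t *_) (B-vanish (k ∸ t) p)) (*-zeroʳ (A t)))) (pow∣0 _)
    ...   | inj₁ jN with k ∸ t in jeq
    ...     | zero = subst (2^ higher ∣_) (sym (trans (cong (A t *_) B-zero) (*-zeroʳ (A t)))) (pow∣0 _)
    ...     | suc j = pow∣-weaken
                (subst (λ z → higher ≤ νA n t + νB n z) jeq (others t (≤-pred tk) ne tN (subst (1 ≤_) (sym jeq) (s≤s z≤n)) (subst (_≤ N) (sym jeq) jN)))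
                (pow∣-* (A-divisible t) (‖⇒∣ (B-exact (suc j) jN (IH (suc j) (s≤s z≤n) jN))))

  exact-base : ExactFormula 1
  exact-base (suc zero) _ _ = ‖-one
  exact-base (suc (suc zero)) _ _ = ‖-one
  exact-base (suc (suc (suc k))) _ (s≤s (s≤s ()))

  exact-formula : ∀ n → 1 ≤ n → ExactFormula n
  exact-formula (suc zero) _ = exact-base
  exact-formula (suc (suc m)) _ = exact-step m (exact-formula (suc m) (s≤s z≤n))

open TwoAdic using (v2-exact)
open FormulaMaximum using (maxAtOne)
open ExactValuation using (ExactFormula; exact-formula)

-- The theorem: both valuations are values of the formula ν, which is maximal at k = 1.
corollary1p4 : (n k : ℕ) → 1 ≤ n → 1 ≤ k → k ≤ 2 ^ n →
    v2 (stirling1 (2 ^ n) k) ≤ v2 (stirling1 (2 ^ n) 1)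
corollary1p4 n k n≥1 k≥1 k≤2^n =
  subst₂ _≤_ (sym (v2-exact (exact k k≥1 k≤2^n))) (sym (v2-exact (exact 1 (s≤s z≤n) (m^n>0 2 n))))
             (maxAtOne n n≥1 k k≥1 k≤2^n)
  where
  exact : ExactFormula n
  exact = exact-formula n n≥1
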